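{- Let $n$ be a positive integer and let $(\mathcal{S},\mathcal{B})$ be a Kirkman quadruple system of order $n$ on the point set $\mathcal{S}=\{0,1,\dots,n-1\}$ with $\min_\Sigma(\mathcal{B}) = n+2$. Then there exists a Kirkman quadruple system $(\mathcal{S}',\mathcal{B}')$ of order $2n$ on the point set $\mathcal{S}'=\{0,1,\dots,2n-1\}$ with $\min_\Sigma(\mathcal{B}') = 2n+2$.
   Context: A Steiner quadruple system $S(3,4,n)$ is a pair $(\mathcal{S},\mathcal{B})$ where $\mathcal{S}$ is a set of $n$ elements and $\mathcal{B}$ is a set of 4-element subsets of $\mathcal{S}$ (blocks) such that every 3-element subset of $\mathcal{S}$ is contained in exactly one block. A parallel class is a subset of $\mathcal{B}$ that partitions $\mathcal{S}$; the system is resolvable if $\mathcal{B}$ can be partitioned into parallel classes. A Kirkman quadruple system of order $n$, $KQS(n)$, is a resolvable $S(3,4,n)$. For a design with $\mathcal{S}=\{0,1,\dots,n-1\}$, the min-sum is $\min_\Sigma(\mathcal{B}) := \min_{B\in\mathcal{B}} \sum_{x\in B} x$. -}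

module Defs where

open import Data.Nat using (ℕ; _≤_; _+_)
open import Data.Fin using (Fin; toℕ)
open import Data.Fin.Subset using (Subset; _∈_; _⊆_; ∣_∣; inside)
open import Data.Fin.Subset.Properties using (_∈?_; _⊆?_)
open import Data.List using (List; length; filter; concat; map; allFin)
open import Data.Nat.ListAction using (sum)
open import Data.List.Membership.Propositional using () renaming (_∈_ to _∈ₗ_)
open import Data.List.Relation.Binary.Permutation.Propositional using (_↭_)
open import Data.Product using (Σ; _×_; ∃)
open import Relation.Binary.PropositionalEquality using (_≡_)

countContaining : {n : ℕ} → Subset n → List (Subset n) → ℕ
countContaining T 𝓑 = length (filter (T ⊆?_) 𝓑)

countPoint : {n : ℕ} → Fin n → List (Subset n) → ℕ
countPoint x 𝓑 = length (filter (x ∈?_) 𝓑)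

-- Steiner quadruple system S(3,4,n): every block has 4 elements and every
-- 3-element subset is contained in exactly one block (this also forces the
-- list to contain no repeated block, so it represents a set of blocks).
IsSQS : (n : ℕ) → List (Subset n) → Set
IsSQS n 𝓑 =
  ((B : Subset n) → B ∈ₗ 𝓑 → ∣ B ∣ ≡ 4) ×
  ((T : Subset n) → ∣ T ∣ ≡ 3 → countContaining T 𝓑 ≡ 1)

IsParallelClass : (n : ℕ) → List (Subset n) → Set
IsParallelClass n C = (x : Fin n) → countPoint x C ≡ 1

IsResolvable : (n : ℕ) → List (Subset n) → Set
IsResolvable n 𝓑 =
  Σ (List (List (Subset n))) λ R →
    (concat R ↭ 𝓑) × ((C : List (Subset n)) → C ∈ₗ R → IsParallelClass n C)

IsKQS : (n : ℕ) → List (Subset n) → Set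
IsKQS n 𝓑 = IsSQS n 𝓑 × IsResolvable n 𝓑

blockSum : {n : ℕ} → Subset n → ℕ
blockSum {n} B = sum (map toℕ (filter (_∈? B) (allFin n)))

MinSumIs : {n : ℕ} → List (Subset n) → ℕ → Set
MinSumIs 𝓑 m =
  (∃ λ B → B ∈ₗ 𝓑 × blockSum B ≡ m) ×
  ((B : _) → B ∈ₗ 𝓑 → m ≤ blockSum B)

-- Take the points S × {0, 1}, the left copy of S first. Every block B of the
-- KQS(n) and every e ∈ B give the two blocks (B ∖ e) × {0} ∪ {e} × {1} and {e} × {0} ∪ (B ∖ e) × {1};
-- every edge {x, y} of a one-factorisation of K_n gives {x, y} × {0, 1}. A triple with all its points
-- in one copy lies only in the split of the block through it at its fourth point; a triple with two
-- points in one copy lies in a split block if its projection to S has three points, and otherwise in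
-- the doubled edge through its projection. Splitting every block of a parallel class at its k-th point
-- (k < 4) gives a parallel class, and so does doubling a one-factor. A split block has sum
-- Σ B + n or Σ B + 3n and a doubled edge 2 (x + y) + 2n with x + y ≥ 1, so min-sum n + 2 becomes
-- 2n + 2. A parallel class of quadruples forces 4 ∣ n, and for even n the round-robin tournament
-- one-factorises K_n.
module Submission where

open import Defs
open import Data.Nat using (ℕ; _≤_; _+_; _*_)
open import Data.Fin.Subset using (Subset)
open import Data.List using (List)
open import Data.Product using (Σ; _×_)

open import Data.Bool using (Bool; true; false; _∧_; _∨_; not)
open import Data.Bool.Properties using (∧-zeroʳ; ∧-identityʳ; ∧-comm; ∨-zeroʳ)
open import Data.Empty using (⊥-elim)
open import Data.Fin using (Fin; toℕ; fromℕ<; splitAt; _↑ˡ_; _↑ʳ_; punchIn; punchOut)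
open import Data.Fin.Properties
  using (_≟_; toℕ-fromℕ<; toℕ<n; toℕ≤pred[n]; toℕ-injective; toℕ-↑ˡ; toℕ-↑ʳ;
         punchInᵢ≢i; punchIn-punchOut; punchIn-injective)
  renaming (_<?_ to _<ᶠ?_; <-cmp to <ᶠ-cmp)
open import Data.Fin.Subset using (_∈_; _⊆_; ∣_∣; ⁅_⁆; _∪_) renaming (⊥ to ∅)
open import Data.Fin.Subset.Properties
  using (_∈?_; _⊆?_; ∪-identityˡ; ∪-identityʳ; ∪-comm; p⊆q⇒∣p∣≤∣q∣; ∣⁅x⁆∣≡1)
open import Data.List
  using ([]; _∷_; length; filter; concat; concatMap; map; allFin; tabulate; take; drop; upTo; applyUpTo)
  renaming (_++_ to _++ₗ_)
open import Data.List.Properties using (map-++; map-∘; map-upTo)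
open import Data.List.Membership.Propositional using (find) renaming (_∈_ to _∈ₗ_)
open import Data.List.Membership.Propositional.Properties
  using (∈-map⁺; ∈-map⁻; ∈-concat⁺′; ∈-concat⁻′; ∈-concatMap⁻; ∈-filter⁻; ∈-++⁺ˡ; ∈-++⁻; ∈-upTo⁺; ∈-upTo⁻)
open import Data.List.Relation.Binary.Permutation.Propositional using (_↭_; ↭-sym; ↭-refl)
import Data.List.Relation.Binary.Permutation.Propositional.Properties as ↭
open import Data.List.Relation.Unary.Any using (here; there)
open import Data.Nat using (zero; suc; _<_; z≤n; s≤s; s≤s⁻¹; _≤?_; _∸_; _%_; NonZero; ≢-nonZero)
open import Data.Nat.DivMod
  using (%-distribˡ-+; %-distribˡ-*; m%n%n≡m%n; [m+n]%n≡m%n; [m+kn]%n≡m%n; m%n<n; m<n⇒m%n≡m)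
open import Data.Nat.ListAction using (sum)
open import Data.Nat.ListAction.Properties using (sum-++; sum-↭)
open import Data.Nat.Properties renaming (_≟_ to _≟ℕ_)
open import Data.Nat.Tactic.RingSolver using (solve-∀)
open import Data.Product using (_,_; ∃; ∃₂; proj₁; proj₂)
open import Data.Sum using (_⊎_; inj₁; inj₂; [_,_]′)
open import Data.Vec using ([]; _∷_; lookup; _++_)
import Data.Vec as V
open import Data.Vec.Properties
  using (lookup-replicate; []=⇒lookup; lookup⇒[]=; lookup-++ˡ; lookup-++ʳ; lookup-zipWith; lookup-splitAt)
open import Function using (_∘_)
open import Relation.Binary using (tri<; tri≈; tri>)
open import Relation.Binary.PropositionalEquality
open import Relation.Nullary using (Dec; does; yes; no)
open import Relation.Nullary.Decidable using (dec-true; dec-false)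
open import Relation.Unary using (Decidable)
open import Algebra.Properties.Semiring.Sum +-*-semiring
  using (sum-syntax; ∑-distrib-+; sum-cong-≗; sum-remove; sum-replicate-zero)
  renaming (sum to ∑)

open ≡-Reasoning

private
  variable
    A B : Set
    n : ℕ

𝟙 : Bool → ℕ
𝟙 true = 1
𝟙 false = 0

𝟙-∧ : ∀ a b → 𝟙 (a ∧ b) ≡ 𝟙 a * 𝟙 b
𝟙-∧ true b = sym (+-identityʳ (𝟙 b))
𝟙-∧ false b = refl

∑ₗ : (A → ℕ) → List A → ℕ
∑ₗ f xs = sum (map f xs)

∑ₗ-cong : {f g : A → ℕ} (xs : List A) → (∀ x → x ∈ₗ xs → f x ≡ g x) → ∑ₗ f xs ≡ ∑ₗ g xs
∑ₗ-cong [] h = refl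
∑ₗ-cong (x ∷ xs) h = cong₂ _+_ (h x (here refl)) (∑ₗ-cong xs (λ y y∈ → h y (there y∈)))

∑ₗ-zero : {f : A → ℕ} (xs : List A) → (∀ x → x ∈ₗ xs → f x ≡ 0) → ∑ₗ f xs ≡ 0
∑ₗ-zero [] h = refl
∑ₗ-zero (x ∷ xs) h = cong₂ _+_ (h x (here refl)) (∑ₗ-zero xs (λ y y∈ → h y (there y∈)))

∑ₗ-const : (c : ℕ) (xs : List A) → ∑ₗ (λ _ → c) xs ≡ length xs * c
∑ₗ-const c [] = refl
∑ₗ-const c (x ∷ xs) = cong (c +_) (∑ₗ-const c xs)

∑ₗ-distrib-+ : (f g : A → ℕ) (xs : List A) → ∑ₗ (λ x → f x + g x) xs ≡ ∑ₗ f xs + ∑ₗ g xs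
∑ₗ-distrib-+ f g [] = refl
∑ₗ-distrib-+ f g (x ∷ xs) = begin
  f x + g x + ∑ₗ (λ y → f y + g y) xs  ≡⟨ cong (f x + g x +_) (∑ₗ-distrib-+ f g xs) ⟩
  f x + g x + (∑ₗ f xs + ∑ₗ g xs)      ≡⟨ +-assoc (f x) (g x) _ ⟩
  f x + (g x + (∑ₗ f xs + ∑ₗ g xs))    ≡⟨ cong (f x +_) (+-exchange (g x) (∑ₗ f xs) _) ⟩
  f x + (∑ₗ f xs + (g x + ∑ₗ g xs))    ≡⟨ +-assoc (f x) _ _ ⟨
  ∑ₗ f (x ∷ xs) + ∑ₗ g (x ∷ xs)        ∎
  where
  +-exchange : ∀ a b c → a + (b + c) ≡ b + (a + c)
  +-exchange a b c = trans (sym (+-assoc a b c)) (trans (cong (_+ c) (+-comm a b)) (+-assoc b a c))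

∑ₗ-++ : (f : A → ℕ) (xs ys : List A) → ∑ₗ f (xs ++ₗ ys) ≡ ∑ₗ f xs + ∑ₗ f ys
∑ₗ-++ f xs ys = trans (cong sum (map-++ f xs ys)) (sum-++ (map f xs) (map f ys))

∑ₗ-concat : (f : A → ℕ) (xss : List (List A)) → ∑ₗ f (concat xss) ≡ ∑ₗ (∑ₗ f) xss
∑ₗ-concat f [] = refl
∑ₗ-concat f (xs ∷ xss) = trans (∑ₗ-++ f xs (concat xss)) (cong (∑ₗ f xs +_) (∑ₗ-concat f xss))

∑ₗ-↭ : (f : A → ℕ) {xs ys : List A} → xs ↭ ys → ∑ₗ f xs ≡ ∑ₗ f ys
∑ₗ-↭ f p = sum-↭ (↭.map⁺ f p)

∑ₗ-filter : {P : A → Set} (P? : Decidable P) (f : A → ℕ) (xs : List A) →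
  ∑ₗ f (filter P? xs) ≡ ∑ₗ (λ x → 𝟙 (does (P? x)) * f x) xs
∑ₗ-filter P? f [] = refl
∑ₗ-filter P? f (x ∷ xs) with does (P? x)
... | true = cong₂ _+_ (sym (+-identityʳ (f x))) (∑ₗ-filter P? f xs)
... | false = ∑ₗ-filter P? f xs

length-filter : {P : A → Set} (P? : Decidable P) (xs : List A) →
  length (filter P? xs) ≡ ∑ₗ (λ x → 𝟙 (does (P? x))) xs
length-filter P? [] = refl
length-filter P? (x ∷ xs) with does (P? x)
... | true = cong suc (length-filter P? xs)
... | false = length-filter P? xs

∑ₗ-map : (f : B → ℕ) (g : A → B) (xs : List A) → ∑ₗ f (map g xs) ≡ ∑ₗ (λ x → f (g x)) xs
∑ₗ-map f g xs = cong sum (sym (map-∘ xs))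

∑ₗ-concatMap : (f : B → ℕ) (g : A → List B) (xs : List A) →
  ∑ₗ f (concatMap g xs) ≡ ∑ₗ (λ x → ∑ₗ f (g x)) xs
∑ₗ-concatMap f g xs = trans (∑ₗ-concat f (map g xs)) (∑ₗ-map (∑ₗ f) g xs)

∑ₗ-tabulate : {n : ℕ} (f : A → ℕ) (g : Fin n → A) → ∑ₗ f (tabulate g) ≡ ∑[ i < n ] f (g i)
∑ₗ-tabulate {n = zero} f g = refl
∑ₗ-tabulate {n = suc n} f g = cong (f (g Fin.zero) +_) (∑ₗ-tabulate f (λ i → g (Fin.suc i)))

∑-zero : {n : ℕ} (f : Fin n → ℕ) → (∀ i → f i ≡ 0) → ∑ f ≡ 0
∑-zero {n} f h = trans (sum-cong-≗ h) (sum-replicate-zero n)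

∑-δ : {n : ℕ} (f : Fin n → ℕ) (a : Fin n) → (∀ i → i ≢ a → f i ≡ 0) → ∑ f ≡ f a
∑-δ {suc n} f a h = begin
  ∑ f                          ≡⟨ sum-remove f ⟩
  f a + ∑ (f ∘ punchIn a)      ≡⟨ cong (f a +_) (∑-zero _ (λ j → h (punchIn a j) (punchInᵢ≢i a j))) ⟩
  f a + 0                      ≡⟨ +-identityʳ (f a) ⟩
  f a                          ∎

∑-δ₂ : {n : ℕ} (f : Fin n → ℕ) (a b : Fin n) → a ≢ b →
  (∀ i → i ≢ a → i ≢ b → f i ≡ 0) → ∑ f ≡ f a + f b
∑-δ₂ {suc n} f a b a≢b h = begin
  ∑ f                       ≡⟨ sum-remove f ⟩
  f a + ∑ (f ∘ punchIn a)   ≡⟨ cong (f a +_) (∑-δ (f ∘ punchIn a) b′ vanish) ⟩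
  f a + f (punchIn a b′)    ≡⟨ cong (λ i → f a + f i) (punchIn-punchOut a≢b) ⟩
  f a + f b                 ∎
  where
  b′ = punchOut a≢b
  vanish : ∀ j → j ≢ b′ → f (punchIn a j) ≡ 0
  vanish j j≢b′ = h (punchIn a j) (punchInᵢ≢i a j)
    (λ eq → j≢b′ (punchIn-injective a j b′ (trans eq (sym (punchIn-punchOut a≢b)))))

∑-const : (n c : ℕ) → ∑[ i < n ] c ≡ n * c
∑-const zero c = refl
∑-const (suc n) c = cong (c +_) (∑-const n c)

∑-≥ : {n : ℕ} (f : Fin n → ℕ) (i : Fin n) → f i ≤ ∑ f
∑-≥ {suc n} f i = subst (f i ≤_) (sym (sum-remove f)) (m≤m+n (f i) _)

∑-↑ : (m k : ℕ) (f : Fin (m + k) → ℕ) → ∑ f ≡ ∑[ i < m ] f (i ↑ˡ k) + ∑[ i < k ] f (m ↑ʳ i)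
∑-↑ zero k f = refl
∑-↑ (suc m) k f = trans (cong (f Fin.zero +_) (∑-↑ m k (f ∘ Fin.suc))) (sym (+-assoc (f Fin.zero) _ _))

∑-∑ₗ-comm : {n : ℕ} (g : Fin n → A → ℕ) (xs : List A) →
  ∑[ i < n ] ∑ₗ (g i) xs ≡ ∑ₗ (λ x → ∑[ i < n ] g i x) xs
∑-∑ₗ-comm {n = n} g [] = ∑-zero {n} _ (λ _ → refl)
∑-∑ₗ-comm g (x ∷ xs) = trans (∑-distrib-+ (λ i → g i x) (λ i → ∑ₗ (g i) xs))
  (cong (∑[ i < _ ] g i x +_) (∑-∑ₗ-comm g xs))

∑ₗ-comm : (h : A → B → ℕ) (xs : List A) (ys : List B) →
  ∑ₗ (λ x → ∑ₗ (h x) ys) xs ≡ ∑ₗ (λ y → ∑ₗ (λ x → h x y) xs) ys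
∑ₗ-comm h [] ys = sym (∑ₗ-zero ys (λ _ _ → refl))
∑ₗ-comm h (x ∷ xs) ys = trans (cong (∑ₗ (h x) ys +_) (∑ₗ-comm h xs ys))
  (sym (∑ₗ-distrib-+ (h x) (λ y → ∑ₗ (λ x′ → h x′ y) xs) ys))

∑ₗ-positions : (f : A → ℕ) (xs : List A) →
  ∑ₗ (λ k → ∑ₗ f (take 1 (drop k xs))) (upTo (length xs)) ≡ ∑ₗ f xs
∑ₗ-positions f [] = refl
∑ₗ-positions f (x ∷ xs) = cong₂ _+_ (+-identityʳ (f x)) (begin
  ∑ₗ (λ k → ∑ₗ f (take 1 (drop k (x ∷ xs)))) (applyUpTo suc (length xs))
    ≡⟨ cong (∑ₗ _) (map-upTo suc (length xs)) ⟨
  ∑ₗ (λ k → ∑ₗ f (take 1 (drop k (x ∷ xs)))) (map suc (upTo (length xs)))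
    ≡⟨ ∑ₗ-map _ suc (upTo (length xs)) ⟩
  ∑ₗ (λ k → ∑ₗ f (take 1 (drop k xs))) (upTo (length xs))
    ≡⟨ ∑ₗ-positions f xs ⟩
  ∑ₗ f xs ∎)

∑ₗ-position : (f : A → ℕ) {v : ℕ} (xs : List A) {k : ℕ} → k < length xs →
  (∀ x → x ∈ₗ xs → f x ≡ v) → ∑ₗ f (take 1 (drop k xs)) ≡ v
∑ₗ-position f (x ∷ xs) {zero} _ h = trans (+-identityʳ (f x)) (h x (here refl))
∑ₗ-position f (x ∷ xs) {suc k} k<len h = ∑ₗ-position f xs (s≤s⁻¹ k<len) (λ y y∈ → h y (there y∈))

∈-position⁻ : {x : A} (xs : List A) (k : ℕ) → x ∈ₗ take 1 (drop k xs) → x ∈ₗ xs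
∈-position⁻ (y ∷ xs) zero (here x≡y) = here x≡y
∈-position⁻ (y ∷ xs) (suc k) x∈ = there (∈-position⁻ xs k x∈)

∈-position⁺ : {x : A} {xs : List A} → x ∈ₗ xs → ∃ λ k → k < length xs × x ∈ₗ take 1 (drop k xs)
∈-position⁺ (here x≡y) = 0 , s≤s z≤n , here x≡y
∈-position⁺ (there x∈) with k , k<len , x∈k ← ∈-position⁺ x∈ = suc k , s≤s k<len , x∈k

∃-∈ₗ : (xs : List A) → 0 < length xs → ∃ λ x → x ∈ₗ xs
∃-∈ₗ (x ∷ xs) _ = x , here refl

∈-concatMap⁻′ : {y : B} (f : A → List B) (xs : List A) → y ∈ₗ concatMap f xs → ∃ λ x → x ∈ₗ xs × y ∈ₗ f x
∈-concatMap⁻′ f xs y∈ = find (∈-concatMap⁻ f {xs = xs} y∈)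

∈-concatMap⁺′ : {x : A} {y : B} (f : A → List B) {xs : List A} → x ∈ₗ xs → y ∈ₗ f x → y ∈ₗ concatMap f xs
∈-concatMap⁺′ f x∈ y∈ = ∈-concat⁺′ y∈ (∈-map⁺ f x∈)

_⊆ᵇ_ : {n : ℕ} → Subset n → Subset n → Bool
p ⊆ᵇ q = does (p ⊆? q)

points : {n : ℕ} → Subset n → List (Fin n)
points {n} p = filter (_∈? p) (allFin n)

sumOn : {n : ℕ} → Subset n → (Fin n → ℕ) → ℕ
sumOn {n} p w = ∑[ i < n ] (𝟙 (lookup p i) * w i)

∈-points⁻ : {p : Subset n} {x : Fin n} → x ∈ₗ points p → x ∈ p
∈-points⁻ {n} {p} x∈ = proj₂ (∈-filter⁻ (_∈? p) {xs = allFin n} x∈)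

does-∈? : (x : Fin n) (p : Subset n) → does (x ∈? p) ≡ lookup p x
does-∈? Fin.zero (true ∷ p) = refl
does-∈? Fin.zero (false ∷ p) = refl
does-∈? (Fin.suc x) (b ∷ p) = does-∈? x p

lookup-∅ : (i : Fin n) → lookup ∅ i ≡ false
lookup-∅ i = lookup-replicate i false

lookup-⁅⁆ : (e i : Fin n) → lookup ⁅ e ⁆ i ≡ does (i ≟ e)
lookup-⁅⁆ Fin.zero Fin.zero = refl
lookup-⁅⁆ Fin.zero (Fin.suc i) = lookup-∅ i
lookup-⁅⁆ (Fin.suc e) Fin.zero = refl
lookup-⁅⁆ (Fin.suc e) (Fin.suc i) = lookup-⁅⁆ e i

∣∣≡sumOn : (p : Subset n) → ∣ p ∣ ≡ sumOn p (λ _ → 1)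
∣∣≡sumOn [] = refl
∣∣≡sumOn (true ∷ p) = cong suc (∣∣≡sumOn p)
∣∣≡sumOn (false ∷ p) = ∣∣≡sumOn p

∑ₗ-points : (w : Fin n → ℕ) (p : Subset n) → ∑ₗ w (points p) ≡ sumOn p w
∑ₗ-points {n} w p = begin
  ∑ₗ w (points p)                                  ≡⟨ ∑ₗ-filter (_∈? p) w (allFin n) ⟩
  ∑ₗ (λ i → 𝟙 (does (i ∈? p)) * w i) (allFin n)    ≡⟨ ∑ₗ-tabulate {n = n} _ (λ i → i) ⟩
  ∑[ i < n ] (𝟙 (does (i ∈? p)) * w i)             ≡⟨ sum-cong-≗ (λ i → cong (λ b → 𝟙 b * w i) (does-∈? i p)) ⟩
  sumOn p w                                        ∎

length-points : (p : Subset n) → length (points p) ≡ ∣ p ∣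
length-points {n} p = begin
  length (points p)          ≡⟨ *-identityʳ _ ⟨
  length (points p) * 1      ≡⟨ ∑ₗ-const 1 (points p) ⟨
  ∑ₗ (λ _ → 1) (points p)    ≡⟨ ∑ₗ-points (λ _ → 1) p ⟩
  sumOn p (λ _ → 1)          ≡⟨ ∣∣≡sumOn p ⟨
  ∣ p ∣                      ∎

blockSum≡sumOn : (p : Subset n) → blockSum p ≡ sumOn p toℕ
blockSum≡sumOn = ∑ₗ-points toℕ

sumOn-⁅⁆ : (w : Fin n → ℕ) (e : Fin n) → sumOn ⁅ e ⁆ w ≡ w e
sumOn-⁅⁆ w e = trans (∑-δ _ e vanish) (trans (cong (λ b → 𝟙 b * w e) here-true) (+-identityʳ (w e)))
  where
  vanish : ∀ i → i ≢ e → 𝟙 (lookup ⁅ e ⁆ i) * w i ≡ 0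
  vanish i i≢e = cong (λ b → 𝟙 b * w i) (trans (lookup-⁅⁆ e i) (dec-false (i ≟ e) i≢e))
  here-true : lookup ⁅ e ⁆ e ≡ true
  here-true = trans (lookup-⁅⁆ e e) (dec-true (e ≟ e) refl)

sumOn-≥ : (w : Fin n → ℕ) {p : Subset n} {x : Fin n} → x ∈ p → w x ≤ sumOn p w
sumOn-≥ w {p} {x} x∈p = subst (_≤ sumOn p w) weight-x (∑-≥ (λ i → 𝟙 (lookup p i) * w i) x)
  where
  weight-x : 𝟙 (lookup p x) * w x ≡ w x
  weight-x = trans (cong (λ b → 𝟙 b * w x) ([]=⇒lookup x∈p)) (+-identityʳ (w x))

-- Removal of a point; unlike the library's `_-_` it computes on constructors.
_∖_ : Subset n → Fin n → Subset n
(b ∷ B) ∖ Fin.zero = false ∷ B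
(b ∷ B) ∖ Fin.suc e = b ∷ (B ∖ e)

𝟙-remove : {B : Subset n} {e : Fin n} → e ∈ B → (i : Fin n) →
  𝟙 (lookup (B ∖ e) i) + 𝟙 (lookup ⁅ e ⁆ i) ≡ 𝟙 (lookup B i)
𝟙-remove {B = true ∷ B} V.here Fin.zero = refl
𝟙-remove {B = true ∷ B} V.here (Fin.suc i) =
  trans (cong (λ b → 𝟙 (lookup B i) + 𝟙 b) (lookup-∅ i)) (+-identityʳ (𝟙 (lookup B i)))
𝟙-remove {B = b ∷ B} (V.there e∈B) Fin.zero = +-identityʳ (𝟙 b)
𝟙-remove {B = b ∷ B} (V.there e∈B) (Fin.suc i) = 𝟙-remove e∈B i

sumOn-remove : (w : Fin n → ℕ) {B : Subset n} {e : Fin n} → e ∈ B →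
  sumOn (B ∖ e) w + w e ≡ sumOn B w
sumOn-remove w {B} {e} e∈B = begin
  sumOn (B ∖ e) w + w e
    ≡⟨ cong (sumOn (B ∖ e) w +_) (sumOn-⁅⁆ w e) ⟨
  sumOn (B ∖ e) w + sumOn ⁅ e ⁆ w
    ≡⟨ ∑-distrib-+ (λ i → 𝟙 (lookup (B ∖ e) i) * w i) (λ i → 𝟙 (lookup ⁅ e ⁆ i) * w i) ⟨
  ∑[ i < _ ] (𝟙 (lookup (B ∖ e) i) * w i + 𝟙 (lookup ⁅ e ⁆ i) * w i)
    ≡⟨ sum-cong-≗ (λ i → trans (sym (*-distribʳ-+ (w i) (𝟙 (lookup (B ∖ e) i)) _))
                                 (cong (_* w i) (𝟙-remove e∈B i))) ⟩
  sumOn B w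
    ∎

suc-∣∖∣ : {B : Subset n} {e : Fin n} → e ∈ B → suc ∣ B ∖ e ∣ ≡ ∣ B ∣
suc-∣∖∣ {B = B} {e} e∈B = begin
  suc ∣ B ∖ e ∣                ≡⟨ +-comm 1 _ ⟩
  ∣ B ∖ e ∣ + 1                ≡⟨ cong (_+ 1) (∣∣≡sumOn (B ∖ e)) ⟩
  sumOn (B ∖ e) (λ _ → 1) + 1  ≡⟨ sumOn-remove (λ _ → 1) e∈B ⟩
  sumOn B (λ _ → 1)            ≡⟨ ∣∣≡sumOn B ⟨
  ∣ B ∣                        ∎

∅-⊆ᵇ : (q : Subset n) → ∅ ⊆ᵇ q ≡ true
∅-⊆ᵇ [] = refl
∅-⊆ᵇ (b ∷ q) = ∅-⊆ᵇ q

⁅⁆-⊆ᵇ : (x : Fin n) (q : Subset n) → ⁅ x ⁆ ⊆ᵇ q ≡ lookup q x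
⁅⁆-⊆ᵇ Fin.zero (true ∷ q) = ∅-⊆ᵇ q
⁅⁆-⊆ᵇ Fin.zero (false ∷ q) = refl
⁅⁆-⊆ᵇ (Fin.suc x) (b ∷ q) = ⁅⁆-⊆ᵇ x q

∪-⊆ᵇ : (p q r : Subset n) → (p ∪ q) ⊆ᵇ r ≡ p ⊆ᵇ r ∧ q ⊆ᵇ r
∪-⊆ᵇ [] [] [] = refl
∪-⊆ᵇ (true ∷ p) (c ∷ q) (false ∷ r) = refl
∪-⊆ᵇ (true ∷ p) (false ∷ q) (true ∷ r) = ∪-⊆ᵇ p q r
∪-⊆ᵇ (true ∷ p) (true ∷ q) (true ∷ r) = ∪-⊆ᵇ p q r
∪-⊆ᵇ (false ∷ p) (false ∷ q) (c ∷ r) = ∪-⊆ᵇ p q r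
∪-⊆ᵇ (false ∷ p) (true ∷ q) (false ∷ r) = sym (∧-zeroʳ (p ⊆ᵇ r))
∪-⊆ᵇ (false ∷ p) (true ∷ q) (true ∷ r) = ∪-⊆ᵇ p q r

++-⊆ᵇ : {m : ℕ} (p r : Subset m) (q s : Subset n) → (p ++ q) ⊆ᵇ (r ++ s) ≡ p ⊆ᵇ r ∧ q ⊆ᵇ s
++-⊆ᵇ [] [] q s = refl
++-⊆ᵇ (false ∷ p) (c ∷ r) q s = ++-⊆ᵇ p r q s
++-⊆ᵇ (true ∷ p) (false ∷ r) q s = refl
++-⊆ᵇ (true ∷ p) (true ∷ r) q s = ++-⊆ᵇ p r q s

⊆ᵇ-remove : (p B : Subset n) (e : Fin n) → p ⊆ᵇ (B ∖ e) ≡ p ⊆ᵇ B ∧ not (lookup p e)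
⊆ᵇ-remove (true ∷ p) (b ∷ B) Fin.zero = sym (∧-zeroʳ ((true ∷ p) ⊆ᵇ (b ∷ B)))
⊆ᵇ-remove (false ∷ p) (b ∷ B) Fin.zero = sym (∧-identityʳ (p ⊆ᵇ B))
⊆ᵇ-remove (false ∷ p) (b ∷ B) (Fin.suc e) = ⊆ᵇ-remove p B e
⊆ᵇ-remove (true ∷ p) (false ∷ B) (Fin.suc e) = refl
⊆ᵇ-remove (true ∷ p) (true ∷ B) (Fin.suc e) = ⊆ᵇ-remove p B e

⊆ᵇ-sound : {p q : Subset n} → p ⊆ᵇ q ≡ true → p ⊆ q
⊆ᵇ-sound {p = p} {q} h with p ⊆? q
... | yes p⊆q = p⊆q
... | no _ with () ← h

⊆ᵇ-false : {p q : Subset n} → ∣ q ∣ < ∣ p ∣ → p ⊆ᵇ q ≡ false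
⊆ᵇ-false {p = p} {q} ∣q∣<∣p∣ = dec-false (p ⊆? q) (λ p⊆q → <⇒≱ ∣q∣<∣p∣ (p⊆q⇒∣p∣≤∣q∣ p⊆q))

∣p∣≡0⇒p≡∅ : (p : Subset n) → ∣ p ∣ ≡ 0 → p ≡ ∅
∣p∣≡0⇒p≡∅ [] _ = refl
∣p∣≡0⇒p≡∅ (false ∷ p) h = cong (false ∷_) (∣p∣≡0⇒p≡∅ p h)

∣p∣≡1⇒p≡⁅x⁆ : (p : Subset n) → ∣ p ∣ ≡ 1 → ∃ λ x → p ≡ ⁅ x ⁆
∣p∣≡1⇒p≡⁅x⁆ (true ∷ p) h = Fin.zero , cong (true ∷_) (∣p∣≡0⇒p≡∅ p (suc-injective h))
∣p∣≡1⇒p≡⁅x⁆ (false ∷ p) h with x , refl ← ∣p∣≡1⇒p≡⁅x⁆ p h = Fin.suc x , refl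

∣p∣≡2⇒p≡⁅x⁆∪⁅y⁆ : (p : Subset n) → ∣ p ∣ ≡ 2 → ∃₂ λ x y → x ≢ y × p ≡ ⁅ x ⁆ ∪ ⁅ y ⁆
∣p∣≡2⇒p≡⁅x⁆∪⁅y⁆ (true ∷ p) h with y , refl ← ∣p∣≡1⇒p≡⁅x⁆ p (suc-injective h) =
  Fin.zero , Fin.suc y , (λ ()) , cong (true ∷_) (sym (∪-identityˡ ⁅ y ⁆))
∣p∣≡2⇒p≡⁅x⁆∪⁅y⁆ (false ∷ p) h with x , y , x≢y , refl ← ∣p∣≡2⇒p≡⁅x⁆∪⁅y⁆ p h =
  Fin.suc x , Fin.suc y , (λ eq → x≢y (Data.Fin.Properties.suc-injective eq)) , refl

∣p∪⁅x⁆∣ : (p : Subset n) (x : Fin n) → lookup p x ≡ false → ∣ p ∪ ⁅ x ⁆ ∣ ≡ suc ∣ p ∣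
∣p∪⁅x⁆∣ (false ∷ p) Fin.zero _ = cong (λ q → suc ∣ q ∣) (∪-identityʳ p)
∣p∪⁅x⁆∣ (true ∷ p) (Fin.suc x) h = cong suc (∣p∪⁅x⁆∣ p x h)
∣p∪⁅x⁆∣ (false ∷ p) (Fin.suc x) h = ∣p∪⁅x⁆∣ p x h

sumOn-+ : (p : Subset n) (f g : Fin n → ℕ) → sumOn p (λ i → f i + g i) ≡ sumOn p f + sumOn p g
sumOn-+ p f g = trans (sum-cong-≗ (λ i → *-distribˡ-+ (𝟙 (lookup p i)) (f i) (g i)))
  (∑-distrib-+ (λ i → 𝟙 (lookup p i) * f i) (λ i → 𝟙 (lookup p i) * g i))

sumOn-const : (p : Subset n) (c : ℕ) → sumOn p (λ _ → c) ≡ ∣ p ∣ * c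
sumOn-const [] c = refl
sumOn-const (true ∷ p) c = cong₂ _+_ (+-identityʳ c) (sumOn-const p c)
sumOn-const (false ∷ p) c = sumOn-const p c

sumOn-++ : {m : ℕ} (p : Subset m) (q : Subset n) (w : Fin (m + n) → ℕ) →
  sumOn (p ++ q) w ≡ sumOn p (λ i → w (i ↑ˡ n)) + sumOn q (λ i → w (m ↑ʳ i))
sumOn-++ {n} {m} p q w = trans (∑-↑ m n _) (cong₂ _+_
  (sum-cong-≗ (λ i → cong (λ b → 𝟙 b * w (i ↑ˡ n)) (lookup-++ˡ p q i)))
  (sum-cong-≗ (λ i → cong (λ b → 𝟙 b * w (m ↑ʳ i)) (lookup-++ʳ p q i))))

∣++∣ : {m : ℕ} (p : Subset m) (q : Subset n) → ∣ p ++ q ∣ ≡ ∣ p ∣ + ∣ q ∣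
∣++∣ p q = begin
  ∣ p ++ q ∣                                   ≡⟨ ∣∣≡sumOn (p ++ q) ⟩
  sumOn (p ++ q) (λ _ → 1)                     ≡⟨ sumOn-++ p q (λ _ → 1) ⟩
  sumOn p (λ _ → 1) + sumOn q (λ _ → 1)        ≡⟨ cong₂ _+_ (∣∣≡sumOn p) (∣∣≡sumOn q) ⟨
  ∣ p ∣ + ∣ q ∣                                ∎

blockSum-++ : {m : ℕ} (p q : Subset m) → blockSum (p ++ q) ≡ blockSum p + ∣ q ∣ * m + blockSum q
blockSum-++ {m} p q = begin
  blockSum (p ++ q)
    ≡⟨ blockSum≡sumOn (p ++ q) ⟩
  sumOn (p ++ q) toℕ
    ≡⟨ sumOn-++ p q toℕ ⟩
  sumOn p (λ i → toℕ (i ↑ˡ m)) + sumOn q (λ i → toℕ (m ↑ʳ i))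
    ≡⟨ cong₂ _+_ (sum-cong-≗ (λ i → cong (𝟙 (lookup p i) *_) (toℕ-↑ˡ i m)))
                 (sum-cong-≗ (λ i → cong (𝟙 (lookup q i) *_) (toℕ-↑ʳ m i))) ⟩
  sumOn p toℕ + sumOn q (λ i → m + toℕ i)
    ≡⟨ cong (sumOn p toℕ +_) (trans (sumOn-+ q (λ _ → m) toℕ) (cong (_+ sumOn q toℕ) (sumOn-const q m))) ⟩
  sumOn p toℕ + (∣ q ∣ * m + sumOn q toℕ)
    ≡⟨ +-assoc (sumOn p toℕ) _ _ ⟨
  sumOn p toℕ + ∣ q ∣ * m + sumOn q toℕ
    ≡⟨ cong₂ (λ a b → a + ∣ q ∣ * m + b) (blockSum≡sumOn p) (blockSum≡sumOn q) ⟨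
  blockSum p + ∣ q ∣ * m + blockSum q
    ∎

∃-∈ : {p : Subset n} → 1 ≤ ∣ p ∣ → ∃ λ x → x ∈ p
∃-∈ {p = true ∷ p} _ = Fin.zero , V.here
∃-∈ {p = false ∷ p} 1≤∣p∣ with x , x∈p ← ∃-∈ {p = p} 1≤∣p∣ = Fin.suc x , V.there x∈p

blockSum-∷-positive : (b : Bool) {p : Subset n} {x : Fin n} → x ∈ p → 1 ≤ blockSum (b ∷ p)
blockSum-∷-positive b {p} {x} x∈p = subst (1 ≤_) (sym (blockSum≡sumOn (b ∷ p)))
  (≤-trans (s≤s z≤n) (sumOn-≥ toℕ {p = b ∷ p} {x = Fin.suc x} (V.there x∈p)))

blockSum-positive : (p : Subset n) → 2 ≤ ∣ p ∣ → 1 ≤ blockSum p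
blockSum-positive (true ∷ p) 2≤∣p∣ = blockSum-∷-positive true (proj₂ (∃-∈ {p = p} (s≤s⁻¹ 2≤∣p∣)))
blockSum-positive (false ∷ p) 2≤∣p∣ =
  blockSum-∷-positive false (proj₂ (∃-∈ {p = p} (≤-trans (s≤s z≤n) 2≤∣p∣)))

-- Triples in the doubled system

sumOn-outside : (x B : Subset n) → x ⊆ᵇ B ≡ true → sumOn B (λ e → 𝟙 (not (lookup x e))) + ∣ x ∣ ≡ ∣ B ∣
sumOn-outside [] [] _ = refl
sumOn-outside (true ∷ x) (true ∷ B) h = trans (+-suc _ ∣ x ∣) (cong suc (sumOn-outside x B h))
sumOn-outside (false ∷ x) (true ∷ B) h = cong suc (sumOn-outside x B h)
sumOn-outside (false ∷ x) (false ∷ B) h = sumOn-outside x B h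

-- The number of blocks (B ∖ e) × {0} ∪ {e} × {1} of the doubled system containing x × {0} ∪ y × {1}.
splitCount : Subset n → Subset n → Subset n → ℕ
splitCount x y B = sumOn B (λ e → 𝟙 (x ⊆ᵇ (B ∖ e) ∧ y ⊆ᵇ ⁅ e ⁆))

splitCount-∅ : (x B : Subset n) → x ⊆ᵇ B ≡ true → splitCount x ∅ B + ∣ x ∣ ≡ ∣ B ∣
splitCount-∅ x B x⊆B = trans (cong (_+ ∣ x ∣) (sum-cong-≗ outside)) (sumOn-outside x B x⊆B)
  where
  outside : ∀ e → 𝟙 (lookup B e) * 𝟙 (x ⊆ᵇ (B ∖ e) ∧ ∅ ⊆ᵇ ⁅ e ⁆) ≡ 𝟙 (lookup B e) * 𝟙 (not (lookup x e))
  outside e = cong (λ b → 𝟙 (lookup B e) * 𝟙 b) (begin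
    x ⊆ᵇ (B ∖ e) ∧ ∅ ⊆ᵇ ⁅ e ⁆      ≡⟨ cong₂ _∧_ (⊆ᵇ-remove x B e) (∅-⊆ᵇ ⁅ e ⁆) ⟩
    (x ⊆ᵇ B ∧ not (lookup x e)) ∧ true  ≡⟨ ∧-identityʳ _ ⟩
    x ⊆ᵇ B ∧ not (lookup x e)         ≡⟨ cong (_∧ not (lookup x e)) x⊆B ⟩
    not (lookup x e)                  ∎)

splitCount-⁅⁆ : (x B : Subset n) (c : Fin n) →
  splitCount x ⁅ c ⁆ B ≡ 𝟙 (lookup B c ∧ (x ⊆ᵇ B ∧ not (lookup x c)))
splitCount-⁅⁆ x B c = begin
  splitCount x ⁅ c ⁆ B                                      ≡⟨ ∑-δ _ c vanish ⟩
  𝟙 (lookup B c) * 𝟙 (x ⊆ᵇ (B ∖ c) ∧ ⁅ c ⁆ ⊆ᵇ ⁅ c ⁆)          ≡⟨ cong (λ b → 𝟙 (lookup B c) * 𝟙 b) at-c ⟩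
  𝟙 (lookup B c) * 𝟙 (x ⊆ᵇ B ∧ not (lookup x c))            ≡⟨ 𝟙-∧ (lookup B c) _ ⟨
  𝟙 (lookup B c ∧ (x ⊆ᵇ B ∧ not (lookup x c)))              ∎
  where
  ⁅c⁆⊆ᵇ⁅e⁆ : ∀ e → ⁅ c ⁆ ⊆ᵇ ⁅ e ⁆ ≡ does (c ≟ e)
  ⁅c⁆⊆ᵇ⁅e⁆ e = trans (⁅⁆-⊆ᵇ c ⁅ e ⁆) (lookup-⁅⁆ e c)
  vanish : ∀ e → e ≢ c → 𝟙 (lookup B e) * 𝟙 (x ⊆ᵇ (B ∖ e) ∧ ⁅ c ⁆ ⊆ᵇ ⁅ e ⁆) ≡ 0
  vanish e e≢c = begin
    𝟙 (lookup B e) * 𝟙 (x ⊆ᵇ (B ∖ e) ∧ ⁅ c ⁆ ⊆ᵇ ⁅ e ⁆)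
      ≡⟨ cong (λ b → 𝟙 (lookup B e) * 𝟙 (x ⊆ᵇ (B ∖ e) ∧ b))
              (trans (⁅c⁆⊆ᵇ⁅e⁆ e) (dec-false (c ≟ e) (e≢c ∘ sym))) ⟩
    𝟙 (lookup B e) * 𝟙 (x ⊆ᵇ (B ∖ e) ∧ false)
      ≡⟨ cong (λ b → 𝟙 (lookup B e) * 𝟙 b) (∧-zeroʳ _) ⟩
    𝟙 (lookup B e) * 0
      ≡⟨ *-zeroʳ (𝟙 (lookup B e)) ⟩
    0 ∎
  at-c : x ⊆ᵇ (B ∖ c) ∧ ⁅ c ⁆ ⊆ᵇ ⁅ c ⁆ ≡ x ⊆ᵇ B ∧ not (lookup x c)
  at-c = begin
    x ⊆ᵇ (B ∖ c) ∧ ⁅ c ⁆ ⊆ᵇ ⁅ c ⁆  ≡⟨ cong₂ _∧_ (⊆ᵇ-remove x B c) (trans (⁅c⁆⊆ᵇ⁅e⁆ c) (dec-true (c ≟ c) refl)) ⟩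
    (x ⊆ᵇ B ∧ not (lookup x c)) ∧ true  ≡⟨ ∧-identityʳ _ ⟩
    x ⊆ᵇ B ∧ not (lookup x c)         ∎

splitCount-large : (x y B : Subset n) → 2 ≤ ∣ y ∣ → splitCount x y B ≡ 0
splitCount-large x y B 2≤∣y∣ = ∑-zero _ (λ e → begin
  𝟙 (lookup B e) * 𝟙 (x ⊆ᵇ (B ∖ e) ∧ y ⊆ᵇ ⁅ e ⁆)
    ≡⟨ cong (λ b → 𝟙 (lookup B e) * 𝟙 (x ⊆ᵇ (B ∖ e) ∧ b))
            (⊆ᵇ-false {p = y} (subst (_< ∣ y ∣) (sym (∣⁅x⁆∣≡1 e)) 2≤∣y∣)) ⟩
  𝟙 (lookup B e) * 𝟙 (x ⊆ᵇ (B ∖ e) ∧ false)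
    ≡⟨ cong (λ b → 𝟙 (lookup B e) * 𝟙 b) (∧-zeroʳ _) ⟩
  𝟙 (lookup B e) * 0
    ≡⟨ *-zeroʳ (𝟙 (lookup B e)) ⟩
  0 ∎)

splitCount-⊈ : (x y B : Subset n) → x ⊆ᵇ B ≡ false → splitCount x y B ≡ 0
splitCount-⊈ x y B x⊈B = ∑-zero _ (λ e → begin
  𝟙 (lookup B e) * 𝟙 (x ⊆ᵇ (B ∖ e) ∧ y ⊆ᵇ ⁅ e ⁆)
    ≡⟨ cong (λ b → 𝟙 (lookup B e) * 𝟙 (b ∧ y ⊆ᵇ ⁅ e ⁆))
            (trans (⊆ᵇ-remove x B e) (cong (_∧ not (lookup x e)) x⊈B)) ⟩
  𝟙 (lookup B e) * 0
    ≡⟨ *-zeroʳ (𝟙 (lookup B e)) ⟩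
  0 ∎)

countContaining-∑ₗ : (T : Subset n) (L : List (Subset n)) → countContaining T L ≡ ∑ₗ (λ B → 𝟙 (T ⊆ᵇ B)) L
countContaining-∑ₗ T = length-filter (T ⊆?_)

countPoint-∑ₗ : (x : Fin n) (L : List (Subset n)) → countPoint x L ≡ ∑ₗ (λ B → 𝟙 (lookup B x)) L
countPoint-∑ₗ x L = trans (length-filter (x ∈?_) L) (∑ₗ-cong L (λ B _ → cong 𝟙 (does-∈? x B)))

module TripleCount {n : ℕ} (𝓑 : List (Subset n)) (block-size : ∀ B → B ∈ₗ 𝓑 → ∣ B ∣ ≡ 4)
  (triple-once : ∀ T → ∣ T ∣ ≡ 3 → countContaining T 𝓑 ≡ 1)
  (E : List (Subset n)) (edge-size : ∀ p → p ∈ₗ E → ∣ p ∣ ≡ 2)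
  (pair-once : ∀ X → ∣ X ∣ ≡ 2 → countContaining X E ≡ 1) where

  tripleCount : Subset n → Subset n → ℕ
  tripleCount t₀ t₁ =
    ∑ₗ (λ B → splitCount t₀ t₁ B + splitCount t₁ t₀ B) 𝓑 + ∑ₗ (λ p → 𝟙 (t₀ ⊆ᵇ p ∧ t₁ ⊆ᵇ p)) E

  tripleCount-comm : (t₀ t₁ : Subset n) → tripleCount t₀ t₁ ≡ tripleCount t₁ t₀
  tripleCount-comm t₀ t₁ = cong₂ _+_
    (∑ₗ-cong 𝓑 (λ B _ → +-comm (splitCount t₀ t₁ B) _))
    (∑ₗ-cong E (λ p _ → cong 𝟙 (∧-comm (t₀ ⊆ᵇ p) _)))

  edge-⊉ : (X : Subset n) {p : Subset n} → ∣ X ∣ ≡ 3 → p ∈ₗ E → X ⊆ᵇ p ≡ false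
  edge-⊉ X {p} ∣X∣≡3 p∈E = ⊆ᵇ-false {p = X} (subst₂ _<_ (sym (edge-size p p∈E)) (sym ∣X∣≡3) ≤-refl)

  reverse-vanishes : (t₀ t₁ B : Subset n) → 2 ≤ ∣ t₀ ∣ →
    splitCount t₀ t₁ B + splitCount t₁ t₀ B ≡ splitCount t₀ t₁ B
  reverse-vanishes t₀ t₁ B 2≤∣t₀∣ =
    trans (cong (splitCount t₀ t₁ B +_) (splitCount-large t₁ t₀ B 2≤∣t₀∣)) (+-identityʳ _)

  tripleCount-3-0 : (t₀ : Subset n) → ∣ t₀ ∣ ≡ 3 → tripleCount t₀ ∅ ≡ 1
  tripleCount-3-0 t₀ ∣t₀∣≡3 = begin
    tripleCount t₀ ∅                 ≡⟨ cong₂ _+_ (∑ₗ-cong 𝓑 block-term) (∑ₗ-zero E edge-term) ⟩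
    ∑ₗ (λ B → 𝟙 (t₀ ⊆ᵇ B)) 𝓑 + 0     ≡⟨ +-identityʳ _ ⟩
    ∑ₗ (λ B → 𝟙 (t₀ ⊆ᵇ B)) 𝓑         ≡⟨ countContaining-∑ₗ t₀ 𝓑 ⟨
    countContaining t₀ 𝓑             ≡⟨ triple-once t₀ ∣t₀∣≡3 ⟩
    1                                ∎
    where
    splitCount-3-0 : ∀ B → B ∈ₗ 𝓑 → splitCount t₀ ∅ B ≡ 𝟙 (t₀ ⊆ᵇ B)
    splitCount-3-0 B B∈𝓑 with t₀ ⊆ᵇ B in t₀⊆B
    ... | false = splitCount-⊈ t₀ ∅ B t₀⊆B
    ... | true = +-cancelʳ-≡ 3 _ 1 (begin
      splitCount t₀ ∅ B + 3      ≡⟨ cong (splitCount t₀ ∅ B +_) ∣t₀∣≡3 ⟨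
      splitCount t₀ ∅ B + ∣ t₀ ∣  ≡⟨ splitCount-∅ t₀ B t₀⊆B ⟩
      ∣ B ∣                      ≡⟨ block-size B B∈𝓑 ⟩
      4                          ∎)
    block-term : ∀ B → B ∈ₗ 𝓑 → splitCount t₀ ∅ B + splitCount ∅ t₀ B ≡ 𝟙 (t₀ ⊆ᵇ B)
    block-term B B∈𝓑 = trans (reverse-vanishes t₀ ∅ B (subst (2 ≤_) (sym ∣t₀∣≡3) (s≤s (s≤s z≤n))))
      (splitCount-3-0 B B∈𝓑)
    edge-term : ∀ p → p ∈ₗ E → 𝟙 (t₀ ⊆ᵇ p ∧ ∅ ⊆ᵇ p) ≡ 0
    edge-term p p∈E = cong (λ b → 𝟙 (b ∧ ∅ ⊆ᵇ p)) (edge-⊉ t₀ ∣t₀∣≡3 p∈E)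

  tripleCount-2-1 : (t₀ : Subset n) (c : Fin n) → ∣ t₀ ∣ ≡ 2 → tripleCount t₀ ⁅ c ⁆ ≡ 1
  tripleCount-2-1 t₀ c ∣t₀∣≡2 with lookup t₀ c in c∈t₀
  ... | false = begin
    tripleCount t₀ ⁅ c ⁆          ≡⟨ cong₂ _+_ (∑ₗ-cong 𝓑 block-term) (∑ₗ-zero E edge-term) ⟩
    ∑ₗ (λ B → 𝟙 (X ⊆ᵇ B)) 𝓑 + 0   ≡⟨ +-identityʳ _ ⟩
    ∑ₗ (λ B → 𝟙 (X ⊆ᵇ B)) 𝓑       ≡⟨ countContaining-∑ₗ X 𝓑 ⟨
    countContaining X 𝓑           ≡⟨ triple-once X ∣X∣≡3 ⟩
    1                             ∎
    where
    X = t₀ ∪ ⁅ c ⁆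
    ∣X∣≡3 : ∣ X ∣ ≡ 3
    ∣X∣≡3 = trans (∣p∪⁅x⁆∣ t₀ c c∈t₀) (cong suc ∣t₀∣≡2)
    X-⊆ᵇ : ∀ Z → X ⊆ᵇ Z ≡ t₀ ⊆ᵇ Z ∧ lookup Z c
    X-⊆ᵇ Z = trans (∪-⊆ᵇ t₀ ⁅ c ⁆ Z) (cong (t₀ ⊆ᵇ Z ∧_) (⁅⁆-⊆ᵇ c Z))
    block-term : ∀ B → B ∈ₗ 𝓑 → splitCount t₀ ⁅ c ⁆ B + splitCount ⁅ c ⁆ t₀ B ≡ 𝟙 (X ⊆ᵇ B)
    block-term B _ = trans (reverse-vanishes t₀ ⁅ c ⁆ B (≤-reflexive (sym ∣t₀∣≡2)))
      (trans (splitCount-⁅⁆ t₀ B c) (cong 𝟙 (begin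
        lookup B c ∧ (t₀ ⊆ᵇ B ∧ not (lookup t₀ c))  ≡⟨ cong (λ b → lookup B c ∧ (t₀ ⊆ᵇ B ∧ not b)) c∈t₀ ⟩
        lookup B c ∧ (t₀ ⊆ᵇ B ∧ true)               ≡⟨ cong (lookup B c ∧_) (∧-identityʳ _) ⟩
        lookup B c ∧ t₀ ⊆ᵇ B                        ≡⟨ ∧-comm (lookup B c) _ ⟩
        t₀ ⊆ᵇ B ∧ lookup B c                        ≡⟨ X-⊆ᵇ B ⟨
        X ⊆ᵇ B                                      ∎)))
    edge-term : ∀ p → p ∈ₗ E → 𝟙 (t₀ ⊆ᵇ p ∧ ⁅ c ⁆ ⊆ᵇ p) ≡ 0
    edge-term p p∈E = cong 𝟙 (begin
      t₀ ⊆ᵇ p ∧ ⁅ c ⁆ ⊆ᵇ p   ≡⟨ cong (t₀ ⊆ᵇ p ∧_) (⁅⁆-⊆ᵇ c p) ⟩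
      t₀ ⊆ᵇ p ∧ lookup p c   ≡⟨ X-⊆ᵇ p ⟨
      X ⊆ᵇ p                 ≡⟨ edge-⊉ X ∣X∣≡3 p∈E ⟩
      false                  ∎)
  ... | true = begin
    tripleCount t₀ ⁅ c ⁆          ≡⟨ cong₂ _+_ (∑ₗ-zero 𝓑 block-term) (∑ₗ-cong E edge-term) ⟩
    ∑ₗ (λ p → 𝟙 (t₀ ⊆ᵇ p)) E      ≡⟨ countContaining-∑ₗ t₀ E ⟨
    countContaining t₀ E          ≡⟨ pair-once t₀ ∣t₀∣≡2 ⟩
    1                             ∎
    where
    block-term : ∀ B → B ∈ₗ 𝓑 → splitCount t₀ ⁅ c ⁆ B + splitCount ⁅ c ⁆ t₀ B ≡ 0
    block-term B _ = trans (reverse-vanishes t₀ ⁅ c ⁆ B (≤-reflexive (sym ∣t₀∣≡2)))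
      (trans (splitCount-⁅⁆ t₀ B c) (cong 𝟙 (begin
        lookup B c ∧ (t₀ ⊆ᵇ B ∧ not (lookup t₀ c))  ≡⟨ cong (λ b → lookup B c ∧ (t₀ ⊆ᵇ B ∧ not b)) c∈t₀ ⟩
        lookup B c ∧ (t₀ ⊆ᵇ B ∧ false)              ≡⟨ cong (lookup B c ∧_) (∧-zeroʳ _) ⟩
        lookup B c ∧ false                          ≡⟨ ∧-zeroʳ _ ⟩
        false                                       ∎)))
    edge-term : ∀ p → p ∈ₗ E → 𝟙 (t₀ ⊆ᵇ p ∧ ⁅ c ⁆ ⊆ᵇ p) ≡ 𝟙 (t₀ ⊆ᵇ p)
    edge-term p _ with t₀ ⊆ᵇ p in t₀⊆p
    ... | false = refl
    ... | true = cong 𝟙 (trans (⁅⁆-⊆ᵇ c p) ([]=⇒lookup (⊆ᵇ-sound t₀⊆p (lookup⇒[]= c t₀ c∈t₀))))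

  tripleCount-≥2 : (t₀ t₁ : Subset n) → ∣ t₀ ∣ + ∣ t₁ ∣ ≡ 3 → 2 ≤ ∣ t₀ ∣ → tripleCount t₀ t₁ ≡ 1
  tripleCount-≥2 t₀ t₁ sizes 2≤∣t₀∣ with ∣ t₀ ∣ in ∣t₀∣≡
  ... | 2 with c , refl ← ∣p∣≡1⇒p≡⁅x⁆ t₁ (suc-injective (suc-injective sizes)) = tripleCount-2-1 t₀ c ∣t₀∣≡
  ... | 3 with refl ← ∣p∣≡0⇒p≡∅ t₁ (suc-injective (suc-injective (suc-injective sizes))) =
    tripleCount-3-0 t₀ ∣t₀∣≡
  ... | suc (suc (suc (suc _))) with () ← sizes
  ... | 1 with s≤s () ← 2≤∣t₀∣

  tripleCount-≡1 : (t₀ t₁ : Subset n) → ∣ t₀ ∣ + ∣ t₁ ∣ ≡ 3 → tripleCount t₀ t₁ ≡ 1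
  tripleCount-≡1 t₀ t₁ sizes with 2 ≤? ∣ t₀ ∣
  ... | yes 2≤∣t₀∣ = tripleCount-≥2 t₀ t₁ sizes 2≤∣t₀∣
  ... | no 2≰∣t₀∣ = trans (tripleCount-comm t₀ t₁) (tripleCount-≥2 t₁ t₀ (trans (+-comm ∣ t₁ ∣ _) sizes) 2≤∣t₁∣)
    where
    2≤∣t₁∣ : 2 ≤ ∣ t₁ ∣
    2≤∣t₁∣ = s≤s⁻¹ (subst (_≤ 1 + ∣ t₁ ∣) sizes (+-monoˡ-≤ ∣ t₁ ∣ (s≤s⁻¹ (≰⇒> 2≰∣t₀∣))))

-- One-factorisations of K_n

IsOneFactorisation : (n : ℕ) → List (List (Subset n)) → Set
IsOneFactorisation n 𝓕 =
  ((F : List (Subset n)) → F ∈ₗ 𝓕 → IsParallelClass n F) ×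
  ((p : Subset n) → p ∈ₗ concat 𝓕 → ∣ p ∣ ≡ 2) ×
  ((X : Subset n) → ∣ X ∣ ≡ 2 → countContaining X (concat 𝓕) ≡ 1)

lookup-edge : (x y z : Fin n) → lookup (⁅ x ⁆ ∪ ⁅ y ⁆) z ≡ does (z ≟ x) ∨ does (z ≟ y)
lookup-edge x y z = trans (lookup-zipWith _∨_ z ⁅ x ⁆ ⁅ y ⁆) (cong₂ _∨_ (lookup-⁅⁆ x z) (lookup-⁅⁆ y z))

edge-∋ˡ : (x y : Fin n) → lookup (⁅ x ⁆ ∪ ⁅ y ⁆) x ≡ true
edge-∋ˡ x y = trans (lookup-edge x y x) (cong (_∨ does (x ≟ y)) (dec-true (x ≟ x) refl))

edge-∋ʳ : (x y : Fin n) → lookup (⁅ x ⁆ ∪ ⁅ y ⁆) y ≡ true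
edge-∋ʳ x y = trans (lookup-edge x y y) (trans (cong (does (y ≟ x) ∨_) (dec-true (y ≟ y) refl)) (∨-zeroʳ _))

edge-∌ : (x y z : Fin n) → z ≢ x → z ≢ y → lookup (⁅ x ⁆ ∪ ⁅ y ⁆) z ≡ false
edge-∌ x y z z≢x z≢y = trans (lookup-edge x y z) (cong₂ _∨_ (dec-false (z ≟ x) z≢x) (dec-false (z ≟ y) z≢y))

edge-∋⁻ : (x y z : Fin n) → lookup (⁅ x ⁆ ∪ ⁅ y ⁆) z ≡ true → z ≡ x ⊎ z ≡ y
edge-∋⁻ x y z z∈ with z ≟ x | z ≟ y
... | yes z≡x | _ = inj₁ z≡x
... | no _ | yes z≡y = inj₂ z≡y
... | no z≢x | no z≢y with () ← trans (sym z∈) (edge-∌ x y z z≢x z≢y)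

∣edge∣ : (x y : Fin n) → x ≢ y → ∣ ⁅ x ⁆ ∪ ⁅ y ⁆ ∣ ≡ 2
∣edge∣ x y x≢y = trans (∣p∪⁅x⁆∣ ⁅ x ⁆ y (trans (lookup-⁅⁆ x y) (dec-false (y ≟ x) (x≢y ∘ sym))))
  (cong suc (∣⁅x⁆∣≡1 x))

<-exclusive : (x y : Fin n) → x ≢ y → 𝟙 (does (x <ᶠ? y)) + 𝟙 (does (y <ᶠ? x)) ≡ 1
<-exclusive x y x≢y with <ᶠ-cmp x y
... | tri< x<y _ y≮x = cong₂ (λ a b → 𝟙 a + 𝟙 b) (dec-true (x <ᶠ? y) x<y) (dec-false (y <ᶠ? x) y≮x)
... | tri≈ _ x≡y _ = ⊥-elim (x≢y x≡y)
... | tri> x≮y _ y<x = cong₂ (λ a b → 𝟙 a + 𝟙 b) (dec-false (x <ᶠ? y) x≮y) (dec-true (y <ᶠ? x) y<x)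

module Matchings {n k : ℕ} (σ : Fin k → Fin n → Fin n)
  (σ-fixfree : ∀ c x → σ c x ≢ x) (σ-involutive : ∀ c x → σ c (σ c x) ≡ x)
  (swaps-once : ∀ a b → a ≢ b → ∑[ c < k ] 𝟙 (does (σ c a ≟ b)) ≡ 1) where

  edge : Fin k → Fin n → Subset n
  edge c x = ⁅ x ⁆ ∪ ⁅ σ c x ⁆

  matching : Fin k → List (Subset n)
  matching c = map (edge c) (filter (λ x → x <ᶠ? σ c x) (allFin n))

  matchings : List (List (Subset n))
  matchings = map matching (allFin k)

  ∑ₗ-matching : (f : Subset n → ℕ) (c : Fin k) →
    ∑ₗ f (matching c) ≡ ∑[ x < n ] (𝟙 (does (x <ᶠ? σ c x)) * f (edge c x))
  ∑ₗ-matching f c = trans (∑ₗ-map f (edge c) (filter (λ x → x <ᶠ? σ c x) (allFin n)))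
    (trans (∑ₗ-filter (λ x → x <ᶠ? σ c x) (f ∘ edge c) (allFin n)) (∑ₗ-tabulate {n = n} _ (λ x → x)))

  matching-parallel : ∀ c → IsParallelClass n (matching c)
  matching-parallel c z = begin
    countPoint z (matching c)
      ≡⟨ countPoint-∑ₗ z (matching c) ⟩
    ∑ₗ (λ p → 𝟙 (lookup p z)) (matching c)
      ≡⟨ ∑ₗ-matching (λ p → 𝟙 (lookup p z)) c ⟩
    ∑[ x < n ] (𝟙 (does (x <ᶠ? σ c x)) * 𝟙 (lookup (edge c x) z))
      ≡⟨ ∑-δ₂ _ z (σ c z) (σ-fixfree c z ∘ sym) vanish ⟩
    𝟙 (does (z <ᶠ? σ c z)) * 𝟙 (lookup (edge c z) z)
      + 𝟙 (does (σ c z <ᶠ? σ c (σ c z))) * 𝟙 (lookup (edge c (σ c z)) z)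
      ≡⟨ cong₂ _+_ at-z at-σz ⟩
    𝟙 (does (z <ᶠ? σ c z)) + 𝟙 (does (σ c z <ᶠ? z))
      ≡⟨ <-exclusive z (σ c z) (σ-fixfree c z ∘ sym) ⟩
    1 ∎
    where
    vanish : ∀ x → x ≢ z → x ≢ σ c z → 𝟙 (does (x <ᶠ? σ c x)) * 𝟙 (lookup (edge c x) z) ≡ 0
    vanish x x≢z x≢σz = trans (cong (λ b → 𝟙 (does (x <ᶠ? σ c x)) * 𝟙 b)
        (edge-∌ x (σ c x) z (x≢z ∘ sym) (λ z≡σx → x≢σz (trans (sym (σ-involutive c x)) (cong (σ c) (sym z≡σx))))))
      (*-zeroʳ (𝟙 (does (x <ᶠ? σ c x))))
    at-z : 𝟙 (does (z <ᶠ? σ c z)) * 𝟙 (lookup (edge c z) z) ≡ 𝟙 (does (z <ᶠ? σ c z))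
    at-z = trans (cong (λ b → 𝟙 (does (z <ᶠ? σ c z)) * 𝟙 b) (edge-∋ˡ z (σ c z))) (*-identityʳ _)
    at-σz : 𝟙 (does (σ c z <ᶠ? σ c (σ c z))) * 𝟙 (lookup (edge c (σ c z)) z) ≡ 𝟙 (does (σ c z <ᶠ? z))
    at-σz rewrite σ-involutive c z = trans (cong (λ b → 𝟙 (does (σ c z <ᶠ? z)) * 𝟙 b) (edge-∋ʳ (σ c z) z))
      (*-identityʳ _)

  matching-edge : ∀ c {a b} → toℕ a < toℕ b →
    ∑ₗ (λ p → 𝟙 (lookup p a ∧ lookup p b)) (matching c) ≡ 𝟙 (does (σ c a ≟ b))
  matching-edge c {a} {b} a<b = begin
    ∑ₗ (λ p → 𝟙 (lookup p a ∧ lookup p b)) (matching c)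
      ≡⟨ ∑ₗ-matching (λ p → 𝟙 (lookup p a ∧ lookup p b)) c ⟩
    ∑[ x < n ] (𝟙 (does (x <ᶠ? σ c x)) * 𝟙 (lookup (edge c x) a ∧ lookup (edge c x) b))
      ≡⟨ ∑-δ _ a vanish ⟩
    𝟙 (does (a <ᶠ? σ c a)) * 𝟙 (lookup (edge c a) a ∧ lookup (edge c a) b)
      ≡⟨ at-a ⟩
    𝟙 (does (σ c a ≟ b)) ∎
    where
    a≢b : a ≢ b
    a≢b a≡b = <-irrefl (cong toℕ a≡b) a<b
    both-in-edge : ∀ x → x ≢ a → toℕ x < toℕ (σ c x) → lookup (edge c x) a ∧ lookup (edge c x) b ≡ false
    both-in-edge x x≢a x<σx with lookup (edge c x) a in a∈e
    ... | false = refl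
    ... | true with edge-∋⁻ x (σ c x) a a∈e
    ...   | inj₁ a≡x = ⊥-elim (x≢a (sym a≡x))
    ...   | inj₂ a≡σx = edge-∌ x (σ c x) b b≢x (λ b≡σx → a≢b (trans a≡σx (sym b≡σx)))
      where
      b≢x : b ≢ x
      b≢x b≡x = <-asym a<b (subst₂ (λ u v → toℕ u < toℕ v) (sym b≡x) (sym a≡σx) x<σx)
    vanish : ∀ x → x ≢ a → 𝟙 (does (x <ᶠ? σ c x)) * 𝟙 (lookup (edge c x) a ∧ lookup (edge c x) b) ≡ 0
    vanish x x≢a with x <ᶠ? σ c x
    ... | no x≮σx = cong (λ t → 𝟙 t * 𝟙 (lookup (edge c x) a ∧ lookup (edge c x) b)) (dec-false (x <ᶠ? σ c x) x≮σx)
    ... | yes x<σx = cong₂ (λ s t → 𝟙 s * 𝟙 t) (dec-true (x <ᶠ? σ c x) x<σx) (both-in-edge x x≢a x<σx)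
    at-a : 𝟙 (does (a <ᶠ? σ c a)) * 𝟙 (lookup (edge c a) a ∧ lookup (edge c a) b) ≡ 𝟙 (does (σ c a ≟ b))
    at-a with σ c a ≟ b
    ... | yes refl = cong₂ (λ s t → 𝟙 s * 𝟙 t)
      (dec-true (a <ᶠ? σ c a) a<b) (cong₂ _∧_ (edge-∋ˡ a (σ c a)) (edge-∋ʳ a (σ c a)))
    ... | no σa≢b = trans (cong (λ t → 𝟙 (does (a <ᶠ? σ c a)) * 𝟙 t)
        (trans (cong (_∧ lookup (edge c a) b) (edge-∋ˡ a (σ c a))) (edge-∌ a (σ c a) b (a≢b ∘ sym) (σa≢b ∘ sym))))
      (*-zeroʳ (𝟙 (does (a <ᶠ? σ c a))))

  ∑ₗ-matchings : (f : Subset n → ℕ) → ∑ₗ f (concat matchings) ≡ ∑[ c < k ] ∑ₗ f (matching c)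
  ∑ₗ-matchings f = trans (∑ₗ-concat f matchings)
    (trans (∑ₗ-map (∑ₗ f) matching (allFin k)) (∑ₗ-tabulate {n = k} _ (λ c → c)))

  cover-ordered : ∀ {a b} → toℕ a < toℕ b → countContaining (⁅ a ⁆ ∪ ⁅ b ⁆) (concat matchings) ≡ 1
  cover-ordered {a} {b} a<b = begin
    countContaining X (concat matchings)             ≡⟨ countContaining-∑ₗ X (concat matchings) ⟩
    ∑ₗ (λ p → 𝟙 (X ⊆ᵇ p)) (concat matchings)         ≡⟨ ∑ₗ-matchings (λ p → 𝟙 (X ⊆ᵇ p)) ⟩
    ∑[ c < k ] ∑ₗ (λ p → 𝟙 (X ⊆ᵇ p)) (matching c)    ≡⟨ sum-cong-≗ per-matching ⟩
    ∑[ c < k ] 𝟙 (does (σ c a ≟ b))                  ≡⟨ swaps-once a b (λ a≡b → <-irrefl (cong toℕ a≡b) a<b) ⟩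
    1                                                ∎
    where
    X = ⁅ a ⁆ ∪ ⁅ b ⁆
    per-matching : ∀ c → ∑ₗ (λ p → 𝟙 (X ⊆ᵇ p)) (matching c) ≡ 𝟙 (does (σ c a ≟ b))
    per-matching c = trans (∑ₗ-cong (matching c) (λ p _ → cong 𝟙
      (trans (∪-⊆ᵇ ⁅ a ⁆ ⁅ b ⁆ p) (cong₂ _∧_ (⁅⁆-⊆ᵇ a p) (⁅⁆-⊆ᵇ b p))))) (matching-edge c a<b)

  matchings-cover : ∀ X → ∣ X ∣ ≡ 2 → countContaining X (concat matchings) ≡ 1
  matchings-cover X ∣X∣≡2 with a , b , a≢b , refl ← ∣p∣≡2⇒p≡⁅x⁆∪⁅y⁆ X ∣X∣≡2 | <ᶠ-cmp a b
  ... | tri< a<b _ _ = cover-ordered a<b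
  ... | tri≈ _ a≡b _ = ⊥-elim (a≢b a≡b)
  ... | tri> _ _ b<a =
    subst (λ Y → countContaining Y (concat matchings) ≡ 1) (∪-comm ⁅ b ⁆ ⁅ a ⁆) (cover-ordered b<a)

  oneFactorisation : IsOneFactorisation n matchings
  oneFactorisation = parallel , edge-size , matchings-cover
    where
    parallel : ∀ F → F ∈ₗ matchings → IsParallelClass n F
    parallel F F∈ with c , _ , refl ← ∈-map⁻ matching F∈ = matching-parallel c
    edge-size : ∀ p → p ∈ₗ concat matchings → ∣ p ∣ ≡ 2
    edge-size p p∈
      with F , p∈F , F∈ ← ∈-concat⁻′ matchings p∈
      with c , _ , refl ← ∈-map⁻ matching F∈
      with x , _ , refl ← ∈-map⁻ (edge c) p∈F = ∣edge∣ x (σ c x) (σ-fixfree c x ∘ sym)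

-- Round-robin tournament on Z_N ∪ {∞} (N odd, ∞ represented by N): in round c the point ∞ is paired
-- with c and every other x with 2c − x. The inverse M of 2 modulo N recovers the round from a pair.
module RoundRobin (N M : ℕ) {{_ : NonZero N}} (M+M≡1+N : M + M ≡ suc N) where

  %-absorbˡ-+ : ∀ a b → (a % N + b) % N ≡ (a + b) % N
  %-absorbˡ-+ a b = begin
    (a % N + b) % N              ≡⟨ %-distribˡ-+ (a % N) b N ⟩
    (a % N % N + b % N) % N      ≡⟨ cong (λ t → (t + b % N) % N) (m%n%n≡m%n a N) ⟩
    (a % N + b % N) % N          ≡⟨ %-distribˡ-+ a b N ⟨
    (a + b) % N                  ∎

  %-absorbʳ-+ : ∀ a b → (a + b % N) % N ≡ (a + b) % N
  %-absorbʳ-+ a b = trans (cong (_% N) (+-comm a (b % N)))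
    (trans (%-absorbˡ-+ b a) (cong (_% N) (+-comm b a)))

  %-absorbˡ-* : ∀ a b → (a % N * b) % N ≡ (a * b) % N
  %-absorbˡ-* a b = begin
    (a % N * b) % N              ≡⟨ %-distribˡ-* (a % N) b N ⟩
    (a % N % N * (b % N)) % N    ≡⟨ cong (λ t → (t * (b % N)) % N) (m%n%n≡m%n a N) ⟩
    (a % N * (b % N)) % N        ≡⟨ %-distribˡ-* a b N ⟨
    (a * b) % N                  ∎

  %-cancelˡ : ∀ {x y y′} → x ≤ N → y < N → y′ < N → (x + y) % N ≡ (x + y′) % N → y ≡ y′
  %-cancelˡ {x} {y} {y′} x≤N y<N y′<N eq =
    trans (sym (recover y<N)) (trans (cong (λ t → (t + (N ∸ x)) % N) eq) (recover y′<N))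
    where
    recover : ∀ {z} → z < N → ((x + z) % N + (N ∸ x)) % N ≡ z
    recover {z} z<N = begin
      ((x + z) % N + (N ∸ x)) % N    ≡⟨ %-absorbˡ-+ (x + z) (N ∸ x) ⟩
      (x + z + (N ∸ x)) % N          ≡⟨ cong (_% N) (+-comm (x + z) _) ⟩
      ((N ∸ x) + (x + z)) % N        ≡⟨ cong (_% N) (+-assoc (N ∸ x) x z) ⟨
      ((N ∸ x) + x + z) % N          ≡⟨ cong (λ t → (t + z) % N) (m∸n+n≡m x≤N) ⟩
      (N + z) % N                    ≡⟨ cong (_% N) (+-comm N z) ⟩
      (z + N) % N                    ≡⟨ [m+n]%n≡m%n z N ⟩
      z % N                          ≡⟨ m<n⇒m%n≡m z<N ⟩
      z                              ∎

  double*M : ∀ x → (x + x) * M ≡ x + x * N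
  double*M x = begin
    (x + x) * M      ≡⟨ cong (λ t → (x + t) * M) (*-identityʳ x) ⟨
    (x + x * 1) * M  ≡⟨ cong (_* M) (*-suc x 1) ⟨
    x * 2 * M        ≡⟨ *-assoc x 2 M ⟩
    x * (M + (M + 0)) ≡⟨ cong (λ t → x * (M + t)) (+-identityʳ M) ⟩
    x * (M + M)      ≡⟨ cong (x *_) M+M≡1+N ⟩
    x * suc N        ≡⟨ *-suc x N ⟩
    x + x * N        ∎

  double-injective : ∀ {x y} → x < N → y < N → (x + x) % N ≡ (y + y) % N → x ≡ y
  double-injective {x} {y} x<N y<N eq =
    trans (sym (recover x<N)) (trans (cong (λ t → (t * M) % N) eq) (recover y<N))
    where
    recover : ∀ {z} → z < N → ((z + z) % N * M) % N ≡ z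
    recover {z} z<N = begin
      ((z + z) % N * M) % N    ≡⟨ %-absorbˡ-* (z + z) M ⟩
      ((z + z) * M) % N        ≡⟨ cong (_% N) (double*M z) ⟩
      (z + z * N) % N          ≡⟨ [m+kn]%n≡m%n z z N ⟩
      z % N                    ≡⟨ m<n⇒m%n≡m z<N ⟩
      z                        ∎

  halve : ℕ → ℕ
  halve s = (s * M) % N

  halve-double : ∀ s → (halve s + halve s) % N ≡ s % N
  halve-double s = begin
    (halve s + halve s) % N    ≡⟨ %-absorbˡ-+ (s * M) (halve s) ⟩
    (s * M + halve s) % N      ≡⟨ %-absorbʳ-+ (s * M) (s * M) ⟩
    (s * M + s * M) % N        ≡⟨ cong (_% N) (*-distribˡ-+ s M M) ⟨
    (s * (M + M)) % N          ≡⟨ cong (λ t → (s * t) % N) M+M≡1+N ⟩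
    (s * suc N) % N            ≡⟨ cong (_% N) (*-suc s N) ⟩
    (s + s * N) % N            ≡⟨ [m+kn]%n≡m%n s s N ⟩
    s % N                      ∎

  reflect : ℕ → ℕ → ℕ
  reflect c x = (c + c + (N ∸ x)) % N

  reflect-sum : ∀ c {x} → x ≤ N → (x + reflect c x) % N ≡ (c + c) % N
  reflect-sum c {x} x≤N = begin
    (x + reflect c x) % N       ≡⟨ %-absorbʳ-+ x (c + c + (N ∸ x)) ⟩
    (x + (c + c + (N ∸ x))) % N ≡⟨ cong (λ t → (x + t) % N) (+-comm (c + c) (N ∸ x)) ⟩
    (x + ((N ∸ x) + (c + c))) % N ≡⟨ cong (_% N) (+-assoc x (N ∸ x) (c + c)) ⟨
    (x + (N ∸ x) + (c + c)) % N ≡⟨ cong (λ t → (t + (c + c)) % N) (m+[n∸m]≡n x≤N) ⟩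
    (N + (c + c)) % N           ≡⟨ cong (_% N) (+-comm N (c + c)) ⟩
    (c + c + N) % N             ≡⟨ [m+n]%n≡m%n (c + c) N ⟩
    (c + c) % N                 ∎

  reflect-unique : ∀ c {x y} → x ≤ N → y < N → (x + y) % N ≡ (c + c) % N → y ≡ reflect c x
  reflect-unique c x≤N y<N eq = %-cancelˡ x≤N y<N (m%n<n _ N) (trans eq (sym (reflect-sum c x≤N)))

  partner : ℕ → ℕ → ℕ
  partner c x with x ≟ℕ N
  ... | yes _ = c
  ... | no _ with x ≟ℕ c
  ...   | yes _ = N
  ...   | no _ = reflect c x

  partner-∞ : ∀ c → partner c N ≡ c
  partner-∞ c with N ≟ℕ N
  ... | yes _ = refl
  ... | no N≢N = ⊥-elim (N≢N refl)

  partner-centre : ∀ {c} → c < N → partner c c ≡ N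
  partner-centre {c} c<N with c ≟ℕ N
  ... | yes c≡N = ⊥-elim (<-irrefl c≡N c<N)
  ... | no _ with c ≟ℕ c
  ...   | yes _ = refl
  ...   | no c≢c = ⊥-elim (c≢c refl)

  partner-reflect : ∀ c {x} → x ≢ N → x ≢ c → partner c x ≡ reflect c x
  partner-reflect c {x} x≢N x≢c with x ≟ℕ N
  ... | yes x≡N = ⊥-elim (x≢N x≡N)
  ... | no _ with x ≟ℕ c
  ...   | yes x≡c = ⊥-elim (x≢c x≡c)
  ...   | no _ = refl

  partner-≤ : ∀ {c x} → c < N → partner c x ≤ N
  partner-≤ {c} {x} c<N with x ≟ℕ N
  ... | yes _ = <⇒≤ c<N
  ... | no _ with x ≟ℕ c
  ...   | yes _ = ≤-refl
  ...   | no _ = <⇒≤ (m%n<n _ N)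

  reflect-≢-centre : ∀ {c x} → c < N → x < N → x ≢ c → reflect c x ≢ c
  reflect-≢-centre {c} {x} c<N x<N x≢c r≡c = x≢c (%-cancelˡ (<⇒≤ c<N) x<N c<N (begin
    (c + x) % N             ≡⟨ cong (_% N) (+-comm c x) ⟩
    (x + c) % N             ≡⟨ cong (λ t → (x + t) % N) r≡c ⟨
    (x + reflect c x) % N   ≡⟨ reflect-sum c (<⇒≤ x<N) ⟩
    (c + c) % N             ∎))

  reflect-≢ : ∀ {c x} → c < N → x < N → x ≢ c → reflect c x ≢ x
  reflect-≢ {c} {x} c<N x<N x≢c r≡x = x≢c (double-injective x<N c<N
    (trans (cong (λ t → (x + t) % N) (sym r≡x)) (reflect-sum c (<⇒≤ x<N))))

  partner-≢ : ∀ {c x} → c < N → x ≤ N → partner c x ≢ x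
  partner-≢ {c} {x} c<N x≤N with x ≟ℕ N
  ... | yes x≡N = λ c≡x → <-irrefl (trans c≡x x≡N) c<N
  ... | no x≢N with x ≟ℕ c
  ...   | yes x≡c = λ N≡x → x≢N (sym N≡x)
  ...   | no x≢c = reflect-≢ c<N (≤∧≢⇒< x≤N x≢N) x≢c

  partner-involutive : ∀ {c x} → c < N → x ≤ N → partner c (partner c x) ≡ x
  partner-involutive {c} {x} c<N x≤N with x ≟ℕ N
  ... | yes x≡N = trans (partner-centre c<N) (sym x≡N)
  ... | no x≢N with x ≟ℕ c
  ...   | yes x≡c = trans (partner-∞ c) (sym x≡c)
  ...   | no x≢c = trans (partner-reflect c (<⇒≢ r<N) (reflect-≢-centre c<N x<N x≢c))
      (sym (reflect-unique c (<⇒≤ r<N) x<N (trans (cong (_% N) (+-comm (reflect c x) x)) (reflect-sum c x≤N))))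
    where
    x<N : x < N
    x<N = ≤∧≢⇒< x≤N x≢N
    r<N : reflect c x < N
    r<N = m%n<n _ N

  round : ℕ → ℕ → ℕ
  round a b with a ≟ℕ N
  ... | yes _ = b
  ... | no _ with b ≟ℕ N
  ...   | yes _ = a
  ...   | no _ = halve (a + b)

  round-∞ˡ : ∀ b → round N b ≡ b
  round-∞ˡ b with N ≟ℕ N
  ... | yes _ = refl
  ... | no N≢N = ⊥-elim (N≢N refl)

  round-∞ʳ : ∀ {a} → a ≢ N → round a N ≡ a
  round-∞ʳ {a} a≢N with a ≟ℕ N
  ... | yes a≡N = ⊥-elim (a≢N a≡N)
  ... | no _ with N ≟ℕ N
  ...   | yes _ = refl
  ...   | no N≢N = ⊥-elim (N≢N refl)

  round-halve : ∀ {a b} → a ≢ N → b ≢ N → round a b ≡ halve (a + b)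
  round-halve {a} {b} a≢N b≢N with a ≟ℕ N
  ... | yes a≡N = ⊥-elim (a≢N a≡N)
  ... | no _ with b ≟ℕ N
  ...   | yes b≡N = ⊥-elim (b≢N b≡N)
  ...   | no _ = refl

  round-< : ∀ {a b} → a ≤ N → b ≤ N → a ≢ b → round a b < N
  round-< {a} {b} a≤N b≤N a≢b with a ≟ℕ N
  ... | yes a≡N = ≤∧≢⇒< b≤N (λ b≡N → a≢b (trans a≡N (sym b≡N)))
  ... | no a≢N with b ≟ℕ N
  ...   | yes _ = ≤∧≢⇒< a≤N a≢N
  ...   | no _ = m%n<n _ N

  -- The case splits below are on Dec values passed as arguments: a `with` on `a ≟ℕ N` would also
  -- abstract the same test inside `round` and `partner` and lose the connection to them.
  partner-round : ∀ {a b} → a ≤ N → b ≤ N → a ≢ b → partner (round a b) a ≡ b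
  partner-round {a} {b} a≤N b≤N a≢b = by-cases (a ≟ℕ N) (b ≟ℕ N)
    where
    by-cases : Dec (a ≡ N) → Dec (b ≡ N) → partner (round a b) a ≡ b
    by-cases (yes a≡N) _ = subst (λ a′ → partner (round a′ b) a′ ≡ b) (sym a≡N)
      (trans (cong (λ c → partner c N) (round-∞ˡ b)) (partner-∞ b))
    by-cases (no a≢N) (yes b≡N) = subst (λ b′ → partner (round a b′) a ≡ b′) (sym b≡N)
      (trans (cong (λ c → partner c a) (round-∞ʳ a≢N)) (partner-centre (≤∧≢⇒< a≤N a≢N)))
    by-cases (no a≢N) (no b≢N) = begin
      partner (round a b) a   ≡⟨ cong (λ c → partner c a) (round-halve a≢N b≢N) ⟩
      partner h a             ≡⟨ partner-reflect h a≢N a≢h ⟩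
      reflect h a             ≡⟨ reflect-unique h a≤N (≤∧≢⇒< b≤N b≢N) (sym (halve-double (a + b))) ⟨
      b                       ∎
      where
      h = halve (a + b)
      a≢h : a ≢ h
      a≢h a≡h = a≢b (%-cancelˡ a≤N (≤∧≢⇒< a≤N a≢N) (≤∧≢⇒< b≤N b≢N)
        (trans (cong (λ t → (t + t) % N) a≡h) (halve-double (a + b))))

  round-unique : ∀ {a b c} → a ≤ N → c < N → partner c a ≡ b → c ≡ round a b
  round-unique {a} {b} {c} a≤N c<N pca≡b = by-cases (a ≟ℕ N) (b ≟ℕ N) (a ≟ℕ c)
    where
    by-cases : Dec (a ≡ N) → Dec (b ≡ N) → Dec (a ≡ c) → c ≡ round a b
    by-cases (yes a≡N) _ _ = subst (λ a′ → partner c a′ ≡ b → c ≡ round a′ b) (sym a≡N)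
      (λ pcN≡b → trans (trans (sym (partner-∞ c)) pcN≡b) (sym (round-∞ˡ b))) pca≡b
    by-cases (no a≢N) (yes b≡N) (yes a≡c) =
      trans (sym a≡c) (sym (subst (λ b′ → round a b′ ≡ a) (sym b≡N) (round-∞ʳ a≢N)))
    by-cases (no a≢N) (yes b≡N) (no a≢c) =
      ⊥-elim (<-irrefl (trans (sym (partner-reflect c a≢N a≢c)) (trans pca≡b b≡N)) (m%n<n _ N))
    by-cases (no a≢N) (no b≢N) (yes a≡c) =
      ⊥-elim (b≢N (trans (sym pca≡b) (trans (cong (partner c) a≡c) (partner-centre c<N))))
    by-cases (no a≢N) (no b≢N) (no a≢c) = begin
      c               ≡⟨ double-injective c<N (m%n<n _ N) 2c≡2h ⟩
      halve (a + b)   ≡⟨ round-halve a≢N b≢N ⟨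
      round a b       ∎
      where
      2c≡2h : (c + c) % N ≡ (halve (a + b) + halve (a + b)) % N
      2c≡2h = begin
        (c + c) % N                            ≡⟨ reflect-sum c a≤N ⟨
        (a + reflect c a) % N
          ≡⟨ cong (λ t → (a + t) % N) (trans (sym (partner-reflect c a≢N a≢c)) pca≡b) ⟩
        (a + b) % N                            ≡⟨ halve-double (a + b) ⟨
        (halve (a + b) + halve (a + b)) % N    ∎

  σ : Fin N → Fin (suc N) → Fin (suc N)
  σ c x = fromℕ< (s≤s (partner-≤ {toℕ c} {toℕ x} (toℕ<n c)))

  toℕ-σ : ∀ c x → toℕ (σ c x) ≡ partner (toℕ c) (toℕ x)
  toℕ-σ c x = toℕ-fromℕ< _

  σ-fixfree : ∀ c x → σ c x ≢ x
  σ-fixfree c x σx≡x = partner-≢ (toℕ<n c) (toℕ≤pred[n] x) (trans (sym (toℕ-σ c x)) (cong toℕ σx≡x))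

  σ-involutive : ∀ c x → σ c (σ c x) ≡ x
  σ-involutive c x = toℕ-injective (begin
    toℕ (σ c (σ c x))                        ≡⟨ toℕ-σ c (σ c x) ⟩
    partner (toℕ c) (toℕ (σ c x))            ≡⟨ cong (partner (toℕ c)) (toℕ-σ c x) ⟩
    partner (toℕ c) (partner (toℕ c) (toℕ x)) ≡⟨ partner-involutive (toℕ<n c) (toℕ≤pred[n] x) ⟩
    toℕ x                                    ∎)

  σ-swaps-once : ∀ a b → a ≢ b → ∑[ c < N ] 𝟙 (does (σ c a ≟ b)) ≡ 1
  σ-swaps-once a b a≢b = trans (∑-δ _ r vanish) (cong 𝟙 (dec-true (σ r a ≟ b) σ-r))
    where
    a≤N = toℕ≤pred[n] a
    b≤N = toℕ≤pred[n] b
    r : Fin N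
    r = fromℕ< (round-< a≤N b≤N (a≢b ∘ toℕ-injective))
    σ-r : σ r a ≡ b
    σ-r = toℕ-injective (begin
      toℕ (σ r a)                        ≡⟨ toℕ-σ r a ⟩
      partner (toℕ r) (toℕ a)            ≡⟨ cong (λ c → partner c (toℕ a)) (toℕ-fromℕ< _) ⟩
      partner (round (toℕ a) (toℕ b)) (toℕ a) ≡⟨ partner-round a≤N b≤N (a≢b ∘ toℕ-injective) ⟩
      toℕ b                              ∎)
    vanish : ∀ c → c ≢ r → 𝟙 (does (σ c a ≟ b)) ≡ 0
    vanish c c≢r = cong 𝟙 (dec-false (σ c a ≟ b) (λ σca≡b → c≢r (toℕ-injective
      (trans (round-unique a≤N (toℕ<n c) (trans (sym (toℕ-σ c a)) (cong toℕ σca≡b))) (sym (toℕ-fromℕ< _))))))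

  open Matchings σ σ-fixfree σ-involutive σ-swaps-once public using (matchings; oneFactorisation)

-- The doubling construction

split₁ split₂ : Subset n → Fin n → Subset (n + n)
split₁ B e = (B ∖ e) ++ ⁅ e ⁆
split₂ B e = ⁅ e ⁆ ++ (B ∖ e)

splitPair : Subset n → Fin n → List (Subset (n + n))
splitPair B e = split₁ B e ∷ split₂ B e ∷ []

double : Subset n → Subset (n + n)
double p = p ++ p

-- Every block of C split at its k-th point.
splitClass : List (Subset n) → ℕ → List (Subset (n + n))
splitClass C k = concatMap (λ B → concatMap (splitPair B) (take 1 (drop k (points B)))) C

doubledResolution : List (List (Subset n)) → List (List (Subset n)) → List (List (Subset (n + n)))
doubledResolution R 𝓕 = concatMap (λ C → map (splitClass C) (upTo 4)) R ++ₗ map (map double) 𝓕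

∑ₗ-splitClass : (g : Subset (n + n) → ℕ) (C : List (Subset n)) (k : ℕ) →
  ∑ₗ g (splitClass C k) ≡ ∑ₗ (λ B → ∑ₗ (λ e → ∑ₗ g (splitPair B e)) (take 1 (drop k (points B)))) C
∑ₗ-splitClass g C k = trans (∑ₗ-concatMap g (λ B → concatMap (splitPair B) (take 1 (drop k (points B)))) C)
  (∑ₗ-cong C (λ B _ → ∑ₗ-concatMap g (splitPair B) (take 1 (drop k (points B)))))

base : Fin (n + n) → Fin n
base {n} P = [ (λ z → z) , (λ z → z) ]′ (splitAt n P)

lookup-double : (p : Subset n) (P : Fin (n + n)) → lookup (double p) P ≡ lookup p (base P)
lookup-double {n} p P = trans (lookup-splitAt n p p P) (merge (splitAt n P))
  where
  merge : (s : Fin n ⊎ Fin n) → [ lookup p , lookup p ]′ s ≡ lookup p ([ (λ z → z) , (λ z → z) ]′ s)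
  merge (inj₁ z) = refl
  merge (inj₂ z) = refl

countPoint-splitPair : {B : Subset n} {e : Fin n} → e ∈ B → (P : Fin (n + n)) →
  ∑ₗ (λ B′ → 𝟙 (lookup B′ P)) (splitPair B e) ≡ 𝟙 (lookup B (base P))
countPoint-splitPair {n} {B} {e} e∈B P
  rewrite lookup-splitAt n (B ∖ e) ⁅ e ⁆ P | lookup-splitAt n ⁅ e ⁆ (B ∖ e) P with splitAt n P
... | inj₁ z = trans (cong (𝟙 (lookup (B ∖ e) z) +_) (+-identityʳ _)) (𝟙-remove e∈B z)
... | inj₂ z = trans (cong (𝟙 (lookup ⁅ e ⁆ z) +_) (+-identityʳ _))
  (trans (+-comm (𝟙 (lookup ⁅ e ⁆ z)) _) (𝟙-remove e∈B z))

blockSum-⁅⁆ : (e : Fin n) → blockSum ⁅ e ⁆ ≡ toℕ e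
blockSum-⁅⁆ e = trans (blockSum≡sumOn ⁅ e ⁆) (sumOn-⁅⁆ toℕ e)

blockSum-remove : {B : Subset n} {e : Fin n} → e ∈ B → blockSum (B ∖ e) + toℕ e ≡ blockSum B
blockSum-remove {B = B} {e} e∈B = begin
  blockSum (B ∖ e) + toℕ e    ≡⟨ cong (_+ toℕ e) (blockSum≡sumOn (B ∖ e)) ⟩
  sumOn (B ∖ e) toℕ + toℕ e   ≡⟨ sumOn-remove toℕ e∈B ⟩
  sumOn B toℕ                 ≡⟨ blockSum≡sumOn B ⟨
  blockSum B                  ∎

blockSum-split₁ : {B : Subset n} {e : Fin n} → e ∈ B → blockSum (split₁ B e) ≡ blockSum B + n
blockSum-split₁ {n} {B} {e} e∈B = begin
  blockSum (split₁ B e)                            ≡⟨ blockSum-++ (B ∖ e) ⁅ e ⁆ ⟩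
  blockSum (B ∖ e) + ∣ ⁅ e ⁆ ∣ * n + blockSum ⁅ e ⁆
    ≡⟨ cong₂ (λ k t → blockSum (B ∖ e) + k * n + t) (∣⁅x⁆∣≡1 e) (blockSum-⁅⁆ e) ⟩
  blockSum (B ∖ e) + 1 * n + toℕ e                 ≡⟨ shuffle (blockSum (B ∖ e)) n (toℕ e) ⟩
  blockSum (B ∖ e) + toℕ e + n                     ≡⟨ cong (_+ n) (blockSum-remove e∈B) ⟩
  blockSum B + n                                   ∎
  where
  shuffle : ∀ a m t → a + 1 * m + t ≡ a + t + m
  shuffle = solve-∀

blockSum-split₂ : {B : Subset n} {e : Fin n} → e ∈ B → ∣ B ∖ e ∣ ≡ 3 →
  blockSum (split₂ B e) ≡ blockSum B + 3 * n
blockSum-split₂ {n} {B} {e} e∈B ∣B∖e∣≡3 = begin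
  blockSum (split₂ B e)                            ≡⟨ blockSum-++ ⁅ e ⁆ (B ∖ e) ⟩
  blockSum ⁅ e ⁆ + ∣ B ∖ e ∣ * n + blockSum (B ∖ e)
    ≡⟨ cong₂ (λ t k → t + k * n + blockSum (B ∖ e)) (blockSum-⁅⁆ e) ∣B∖e∣≡3 ⟩
  toℕ e + 3 * n + blockSum (B ∖ e)                 ≡⟨ shuffle (toℕ e) n (blockSum (B ∖ e)) ⟩
  blockSum (B ∖ e) + toℕ e + 3 * n                 ≡⟨ cong (_+ 3 * n) (blockSum-remove e∈B) ⟩
  blockSum B + 3 * n                               ∎
  where
  shuffle : ∀ t m a → t + 3 * m + a ≡ a + t + 3 * m
  shuffle = solve-∀

module Doubling {n : ℕ} (𝓑 : List (Subset n))
  (block-size : ∀ B → B ∈ₗ 𝓑 → ∣ B ∣ ≡ 4) (triple-once : ∀ T → ∣ T ∣ ≡ 3 → countContaining T 𝓑 ≡ 1)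
  (R : List (List (Subset n))) (R↭𝓑 : concat R ↭ 𝓑) (R-parallel : ∀ C → C ∈ₗ R → IsParallelClass n C)
  (𝓕 : List (List (Subset n))) (𝓕-factorisation : IsOneFactorisation n 𝓕) where

  reorder : ∀ m → m + 2 + m ≡ m + m + 2
  reorder = solve-∀

  𝓑′ : List (Subset (n + n))
  𝓑′ = concat (doubledResolution R 𝓕)

  E : List (Subset n)
  E = concat 𝓕

  ∈-resolution : ∀ {B C} → B ∈ₗ C → C ∈ₗ R → B ∈ₗ 𝓑
  ∈-resolution B∈C C∈R = ↭.∈-resp-↭ R↭𝓑 (∈-concat⁺′ B∈C C∈R)

  length-points-block : ∀ {B} → B ∈ₗ 𝓑 → length (points B) ≡ 4
  length-points-block {B} B∈𝓑 = trans (length-points B) (block-size B B∈𝓑)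

  ∑ₗ-splitClasses : (g : Subset (n + n) → ℕ) → ∀ C → C ∈ₗ R →
    ∑ₗ (∑ₗ g) (map (splitClass C) (upTo 4)) ≡ ∑ₗ (λ B → sumOn B (λ e → ∑ₗ g (splitPair B e))) C
  ∑ₗ-splitClasses g C C∈R = begin
    ∑ₗ (∑ₗ g) (map (splitClass C) (upTo 4))
      ≡⟨ ∑ₗ-map (∑ₗ g) (splitClass C) (upTo 4) ⟩
    ∑ₗ (λ k → ∑ₗ g (splitClass C k)) (upTo 4)
      ≡⟨ ∑ₗ-cong (upTo 4) (λ k _ → ∑ₗ-splitClass g C k) ⟩
    ∑ₗ (λ k → ∑ₗ (λ B → ∑ₗ (h B) (take 1 (drop k (points B)))) C) (upTo 4)
      ≡⟨ ∑ₗ-comm (λ k B → ∑ₗ (h B) (take 1 (drop k (points B)))) (upTo 4) C ⟩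
    ∑ₗ (λ B → ∑ₗ (λ k → ∑ₗ (h B) (take 1 (drop k (points B)))) (upTo 4)) C
      ≡⟨ ∑ₗ-cong C all-positions ⟩
    ∑ₗ (λ B → sumOn B (h B)) C
      ∎
    where
    h : Subset n → Fin n → ℕ
    h B e = ∑ₗ g (splitPair B e)
    all-positions : ∀ B → B ∈ₗ C → ∑ₗ (λ k → ∑ₗ (h B) (take 1 (drop k (points B)))) (upTo 4) ≡ sumOn B (h B)
    all-positions B B∈C = trans
      (subst (λ m → ∑ₗ (λ k → ∑ₗ (h B) (take 1 (drop k (points B)))) (upTo m) ≡ ∑ₗ (h B) (points B))
             (length-points-block (∈-resolution B∈C C∈R)) (∑ₗ-positions (h B) (points B)))
      (∑ₗ-points (h B) B)

  ∑ₗ-doubled : (g : Subset (n + n) → ℕ) →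
    ∑ₗ g 𝓑′ ≡ ∑ₗ (λ B → sumOn B (λ e → ∑ₗ g (splitPair B e))) 𝓑 + ∑ₗ (λ p → g (double p)) E
  ∑ₗ-doubled g = begin
    ∑ₗ g 𝓑′
      ≡⟨ ∑ₗ-concat g (doubledResolution R 𝓕) ⟩
    ∑ₗ (∑ₗ g) (doubledResolution R 𝓕)
      ≡⟨ ∑ₗ-++ (∑ₗ g) (concatMap (λ C → map (splitClass C) (upTo 4)) R) _ ⟩
    ∑ₗ (∑ₗ g) (concatMap (λ C → map (splitClass C) (upTo 4)) R) + ∑ₗ (∑ₗ g) (map (map double) 𝓕)
      ≡⟨ cong₂ _+_ split-part double-part ⟩
    ∑ₗ w 𝓑 + ∑ₗ (λ p → g (double p)) E
      ∎
    where
    w : Subset n → ℕ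
    w B = sumOn B (λ e → ∑ₗ g (splitPair B e))
    split-part : ∑ₗ (∑ₗ g) (concatMap (λ C → map (splitClass C) (upTo 4)) R) ≡ ∑ₗ w 𝓑
    split-part = begin
      ∑ₗ (∑ₗ g) (concatMap (λ C → map (splitClass C) (upTo 4)) R)
        ≡⟨ ∑ₗ-concatMap (∑ₗ g) _ R ⟩
      ∑ₗ (λ C → ∑ₗ (∑ₗ g) (map (splitClass C) (upTo 4))) R
        ≡⟨ ∑ₗ-cong R (∑ₗ-splitClasses g) ⟩
      ∑ₗ (∑ₗ w) R
        ≡⟨ ∑ₗ-concat w R ⟨
      ∑ₗ w (concat R)
        ≡⟨ ∑ₗ-↭ w R↭𝓑 ⟩
      ∑ₗ w 𝓑
        ∎
    double-part : ∑ₗ (∑ₗ g) (map (map double) 𝓕) ≡ ∑ₗ (λ p → g (double p)) E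
    double-part = trans (∑ₗ-map (∑ₗ g) (map double) 𝓕)
      (trans (∑ₗ-cong 𝓕 (λ F _ → ∑ₗ-map g double F)) (sym (∑ₗ-concat (λ p → g (double p)) 𝓕)))

  ∈-doubledResolution⁻ : ∀ {L} → L ∈ₗ doubledResolution R 𝓕 →
    (∃₂ λ C k → C ∈ₗ R × k < 4 × L ≡ splitClass C k) ⊎ (∃ λ F → F ∈ₗ 𝓕 × L ≡ map double F)
  ∈-doubledResolution⁻ L∈ with ∈-++⁻ (concatMap (λ C → map (splitClass C) (upTo 4)) R) L∈
  ... | inj₁ L∈splits
    with C , C∈R , L∈C ← ∈-concatMap⁻′ (λ C → map (splitClass C) (upTo 4)) R L∈splits
    with k , k∈ , L≡ ← ∈-map⁻ (splitClass C) L∈C = inj₁ (C , k , C∈R , ∈-upTo⁻ k∈ , L≡)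
  ... | inj₂ L∈doubles
    with F , F∈𝓕 , L≡ ← ∈-map⁻ (map double) L∈doubles = inj₂ (F , F∈𝓕 , L≡)

  ∈-doubled⁻ : ∀ {B′} → B′ ∈ₗ 𝓑′ →
    (∃₂ λ B e → B ∈ₗ 𝓑 × e ∈ B × B′ ∈ₗ splitPair B e) ⊎ (∃ λ p → p ∈ₗ E × B′ ≡ double p)
  ∈-doubled⁻ B′∈ with L , B′∈L , L∈ ← ∈-concat⁻′ (doubledResolution R 𝓕) B′∈
    with ∈-doubledResolution⁻ L∈
  ... | inj₁ (C , k , C∈R , _ , refl)
    with B , B∈C , B′∈B ← ∈-concatMap⁻′ (λ B → concatMap (splitPair B) (take 1 (drop k (points B)))) C B′∈L
    with e , e∈k , B′∈e ← ∈-concatMap⁻′ (splitPair B) (take 1 (drop k (points B))) B′∈B =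
    inj₁ (B , e , ∈-resolution B∈C C∈R , ∈-points⁻ (∈-position⁻ (points B) k e∈k) , B′∈e)
  ... | inj₂ (F , F∈𝓕 , refl)
    with p , p∈F , refl ← ∈-map⁻ double B′∈L = inj₂ (p , ∈-concat⁺′ p∈F F∈𝓕 , refl)

  split₁∈doubled : ∀ {B e} → B ∈ₗ 𝓑 → e ∈ₗ points B → split₁ B e ∈ₗ 𝓑′
  split₁∈doubled {B} {e} B∈𝓑 e∈B
    with C , B∈C , C∈R ← ∈-concat⁻′ R (↭.∈-resp-↭ (↭-sym R↭𝓑) B∈𝓑)
    with k , k<4 , e∈k ← ∈-position⁺ e∈B =
    ∈-concat⁺′ split₁∈class (∈-++⁺ˡ (∈-concatMap⁺′ (λ C → map (splitClass C) (upTo 4)) C∈R class∈))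
    where
    split₁∈class : split₁ B e ∈ₗ splitClass C k
    split₁∈class = ∈-concatMap⁺′ (λ B → concatMap (splitPair B) (take 1 (drop k (points B)))) B∈C
      (∈-concatMap⁺′ (splitPair B) e∈k (here refl))
    class∈ : splitClass C k ∈ₗ map (splitClass C) (upTo 4)
    class∈ = ∈-map⁺ (splitClass C) (∈-upTo⁺ (subst (k <_) (length-points-block B∈𝓑) k<4))

  ∣B∖e∣≡3 : ∀ {B e} → B ∈ₗ 𝓑 → e ∈ B → ∣ B ∖ e ∣ ≡ 3
  ∣B∖e∣≡3 {B} B∈𝓑 e∈B = suc-injective (trans (suc-∣∖∣ e∈B) (block-size B B∈𝓑))

  doubled-block-size : ∀ B′ → B′ ∈ₗ 𝓑′ → ∣ B′ ∣ ≡ 4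
  doubled-block-size B′ B′∈ with ∈-doubled⁻ B′∈
  ... | inj₁ (B , e , B∈𝓑 , e∈B , here refl) =
    trans (∣++∣ (B ∖ e) ⁅ e ⁆) (trans (cong₂ _+_ (∣B∖e∣≡3 B∈𝓑 e∈B) (∣⁅x⁆∣≡1 e)) refl)
  ... | inj₁ (B , e , B∈𝓑 , e∈B , there (here refl)) =
    trans (∣++∣ ⁅ e ⁆ (B ∖ e)) (cong₂ _+_ (∣⁅x⁆∣≡1 e) (∣B∖e∣≡3 B∈𝓑 e∈B))
  ... | inj₂ (p , p∈E , refl) = trans (∣++∣ p p) (cong₂ _+_ (edge-size p p∈E) (edge-size p p∈E))
    where edge-size = proj₁ (proj₂ 𝓕-factorisation)

  open TripleCount 𝓑 block-size triple-once E (proj₁ (proj₂ 𝓕-factorisation)) (proj₂ (proj₂ 𝓕-factorisation))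

  countContaining-doubled : (t₀ t₁ : Subset n) → countContaining (t₀ ++ t₁) 𝓑′ ≡ tripleCount t₀ t₁
  countContaining-doubled t₀ t₁ = begin
    countContaining (t₀ ++ t₁) 𝓑′
      ≡⟨ countContaining-∑ₗ (t₀ ++ t₁) 𝓑′ ⟩
    ∑ₗ (λ B′ → 𝟙 ((t₀ ++ t₁) ⊆ᵇ B′)) 𝓑′
      ≡⟨ ∑ₗ-doubled (λ B′ → 𝟙 ((t₀ ++ t₁) ⊆ᵇ B′)) ⟩
    ∑ₗ (λ B → sumOn B (λ e → ∑ₗ (λ B′ → 𝟙 ((t₀ ++ t₁) ⊆ᵇ B′)) (splitPair B e))) 𝓑
      + ∑ₗ (λ p → 𝟙 ((t₀ ++ t₁) ⊆ᵇ double p)) E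
      ≡⟨ cong₂ _+_ (∑ₗ-cong 𝓑 (λ B _ → split-blocks B))
                   (∑ₗ-cong E (λ p _ → cong 𝟙 (++-⊆ᵇ t₀ p t₁ p))) ⟩
    tripleCount t₀ t₁
      ∎
    where
    split-blocks : ∀ B → sumOn B (λ e → ∑ₗ (λ B′ → 𝟙 ((t₀ ++ t₁) ⊆ᵇ B′)) (splitPair B e))
                         ≡ splitCount t₀ t₁ B + splitCount t₁ t₀ B
    split-blocks B = trans (sum-cong-≗ (λ e → cong (𝟙 (lookup B e) *_) (begin
        𝟙 ((t₀ ++ t₁) ⊆ᵇ split₁ B e) + (𝟙 ((t₀ ++ t₁) ⊆ᵇ split₂ B e) + 0)
          ≡⟨ cong₂ (λ a b → 𝟙 a + (𝟙 b + 0)) (++-⊆ᵇ t₀ (B ∖ e) t₁ ⁅ e ⁆) (++-⊆ᵇ t₀ ⁅ e ⁆ t₁ (B ∖ e)) ⟩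
        𝟙 (t₀ ⊆ᵇ (B ∖ e) ∧ t₁ ⊆ᵇ ⁅ e ⁆) + (𝟙 (t₀ ⊆ᵇ ⁅ e ⁆ ∧ t₁ ⊆ᵇ (B ∖ e)) + 0)
          ≡⟨ cong (𝟙 (t₀ ⊆ᵇ (B ∖ e) ∧ t₁ ⊆ᵇ ⁅ e ⁆) +_)
                  (trans (+-identityʳ _) (cong 𝟙 (∧-comm (t₀ ⊆ᵇ ⁅ e ⁆) _))) ⟩
        𝟙 (t₀ ⊆ᵇ (B ∖ e) ∧ t₁ ⊆ᵇ ⁅ e ⁆) + 𝟙 (t₁ ⊆ᵇ (B ∖ e) ∧ t₀ ⊆ᵇ ⁅ e ⁆)
          ∎)))
      (sumOn-+ B (λ e → 𝟙 (t₀ ⊆ᵇ (B ∖ e) ∧ t₁ ⊆ᵇ ⁅ e ⁆)) (λ e → 𝟙 (t₁ ⊆ᵇ (B ∖ e) ∧ t₀ ⊆ᵇ ⁅ e ⁆)))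

  doubled-triple-once : ∀ T → ∣ T ∣ ≡ 3 → countContaining T 𝓑′ ≡ 1
  doubled-triple-once T ∣T∣≡3 with t₀ , t₁ , refl ← V.splitAt n T =
    trans (countContaining-doubled t₀ t₁) (tripleCount-≡1 t₀ t₁ (trans (sym (∣++∣ t₀ t₁)) ∣T∣≡3))

  splitClass-parallel : ∀ {C k} → C ∈ₗ R → k < 4 → IsParallelClass (n + n) (splitClass C k)
  splitClass-parallel {C} {k} C∈R k<4 P = begin
    countPoint P (splitClass C k)
      ≡⟨ countPoint-∑ₗ P (splitClass C k) ⟩
    ∑ₗ 𝟙P (splitClass C k)
      ≡⟨ ∑ₗ-splitClass 𝟙P C k ⟩
    ∑ₗ (λ B → ∑ₗ (λ e → ∑ₗ 𝟙P (splitPair B e)) (take 1 (drop k (points B)))) C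
      ≡⟨ ∑ₗ-cong C at-position ⟩
    ∑ₗ (λ B → 𝟙 (lookup B (base P))) C
      ≡⟨ countPoint-∑ₗ (base P) C ⟨
    countPoint (base P) C
      ≡⟨ R-parallel C C∈R (base P) ⟩
    1 ∎
    where
    𝟙P : Subset (n + n) → ℕ
    𝟙P B′ = 𝟙 (lookup B′ P)
    at-position : ∀ B → B ∈ₗ C →
      ∑ₗ (λ e → ∑ₗ 𝟙P (splitPair B e)) (take 1 (drop k (points B))) ≡ 𝟙 (lookup B (base P))
    at-position B B∈C = ∑ₗ-position _ (points B)
      (subst (k <_) (sym (length-points-block (∈-resolution B∈C C∈R))) k<4)
      (λ e e∈ → countPoint-splitPair (∈-points⁻ e∈) P)

  doubleClass-parallel : ∀ {F} → F ∈ₗ 𝓕 → IsParallelClass (n + n) (map double F)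
  doubleClass-parallel {F} F∈𝓕 P = begin
    countPoint P (map double F)                   ≡⟨ countPoint-∑ₗ P (map double F) ⟩
    ∑ₗ (λ B′ → 𝟙 (lookup B′ P)) (map double F)    ≡⟨ ∑ₗ-map (λ B′ → 𝟙 (lookup B′ P)) double F ⟩
    ∑ₗ (λ p → 𝟙 (lookup (double p) P)) F          ≡⟨ ∑ₗ-cong F (λ p _ → cong 𝟙 (lookup-double p P)) ⟩
    ∑ₗ (λ p → 𝟙 (lookup p (base P))) F            ≡⟨ countPoint-∑ₗ (base P) F ⟨
    countPoint (base P) F                         ≡⟨ proj₁ 𝓕-factorisation F F∈𝓕 (base P) ⟩
    1                                             ∎

  doubled-isKQS : IsKQS (n + n) 𝓑′
  doubled-isKQS = (doubled-block-size , doubled-triple-once) , (doubledResolution R 𝓕 , ↭-refl , parallel)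
    where
    parallel : ∀ L → L ∈ₗ doubledResolution R 𝓕 → IsParallelClass (n + n) L
    parallel L L∈ with ∈-doubledResolution⁻ L∈
    ... | inj₁ (C , k , C∈R , k<4 , refl) = splitClass-parallel C∈R k<4
    ... | inj₂ (F , F∈𝓕 , refl) = doubleClass-parallel F∈𝓕

  doubled-lower : (∀ B → B ∈ₗ 𝓑 → n + 2 ≤ blockSum B) → ∀ B′ → B′ ∈ₗ 𝓑′ → n + n + 2 ≤ blockSum B′
  doubled-lower lower B′ B′∈ with ∈-doubled⁻ B′∈
  ... | inj₁ (B , e , B∈𝓑 , e∈B , here refl) =
    subst₂ _≤_ (reorder n) (sym (blockSum-split₁ e∈B)) (+-monoˡ-≤ n (lower B B∈𝓑))
  ... | inj₁ (B , e , B∈𝓑 , e∈B , there (here refl)) =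
    subst₂ _≤_ (reorder n) (sym (blockSum-split₂ e∈B (∣B∖e∣≡3 B∈𝓑 e∈B)))
      (+-mono-≤ (lower B B∈𝓑) (m≤m+n n (2 * n)))
  ... | inj₂ (p , p∈E , refl) =
    subst₂ _≤_ (reorder′ n) (sym blockSum-double) (+-mono-≤ (+-monoˡ-≤ (2 * n) 1≤Σp) 1≤Σp)
    where
    ∣p∣≡2 : ∣ p ∣ ≡ 2
    ∣p∣≡2 = proj₁ (proj₂ 𝓕-factorisation) p p∈E
    blockSum-double : blockSum (double p) ≡ blockSum p + 2 * n + blockSum p
    blockSum-double = trans (blockSum-++ p p) (cong (λ k → blockSum p + k * n + blockSum p) ∣p∣≡2)
    1≤Σp : 1 ≤ blockSum p
    1≤Σp = blockSum-positive p (≤-reflexive (sym ∣p∣≡2))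
    reorder′ : ∀ m → 1 + 2 * m + 1 ≡ m + m + 2
    reorder′ = solve-∀

  doubled-attained : (∃ λ B → B ∈ₗ 𝓑 × blockSum B ≡ n + 2) → ∃ λ B′ → B′ ∈ₗ 𝓑′ × blockSum B′ ≡ n + n + 2
  doubled-attained (B , B∈𝓑 , ΣB≡n+2)
    with e , e∈ ← ∃-∈ₗ (points B) (subst (0 <_) (sym (length-points-block B∈𝓑)) (s≤s z≤n)) =
    split₁ B e , split₁∈doubled B∈𝓑 e∈ , (begin
      blockSum (split₁ B e)  ≡⟨ blockSum-split₁ (∈-points⁻ e∈) ⟩
      blockSum B + n         ≡⟨ cong (_+ n) ΣB≡n+2 ⟩
      n + 2 + n              ≡⟨ reorder n ⟩
      n + n + 2              ∎)

  doubled-minSum : MinSumIs 𝓑 (n + 2) → MinSumIs 𝓑′ (n + n + 2)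
  doubled-minSum (attained , lower) = doubled-attained attained , doubled-lower lower

kqs-doubling : {n : ℕ} {𝓑 : List (Subset n)} → IsKQS n 𝓑 → MinSumIs 𝓑 (n + 2) →
  {𝓕 : List (List (Subset n))} → IsOneFactorisation n 𝓕 →
  Σ (List (Subset (n + n))) λ 𝓑′ → IsKQS (n + n) 𝓑′ × MinSumIs 𝓑′ (n + n + 2)
kqs-doubling {𝓑 = 𝓑} ((block-size , triple-once) , R , R↭𝓑 , R-parallel) minSum {𝓕} 𝓕-factorisation =
  𝓑′ , doubled-isKQS , doubled-minSum minSum
  where open Doubling 𝓑 block-size triple-once R R↭𝓑 R-parallel 𝓕 𝓕-factorisation

oneFactorisation-even : (m : ℕ) →
  Σ (List (List (Subset (suc m + suc m)))) (IsOneFactorisation (suc m + suc m))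
oneFactorisation-even m = matchings , oneFactorisation
  where open RoundRobin (m + suc m) (suc m) {{≢-nonZero (m+1+n≢0 m)}} refl

parallelClass-size : {C : List (Subset n)} → IsParallelClass n C → (∀ B → B ∈ₗ C → ∣ B ∣ ≡ 4) →
  n ≡ length C * 4
parallelClass-size {n} {C} parallel block-size = begin
  n                                            ≡⟨ *-identityʳ n ⟨
  n * 1                                        ≡⟨ ∑-const n 1 ⟨
  ∑[ x < n ] 1                                 ≡⟨ sum-cong-≗ (λ x → trans (sym (parallel x)) (countPoint-∑ₗ x C)) ⟩
  ∑[ x < n ] ∑ₗ (λ B → 𝟙 (lookup B x)) C       ≡⟨ ∑-∑ₗ-comm (λ x B → 𝟙 (lookup B x)) C ⟩
  ∑ₗ (λ B → ∑[ x < n ] 𝟙 (lookup B x)) C       ≡⟨ ∑ₗ-cong C size ⟩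
  ∑ₗ (λ _ → 4) C                               ≡⟨ ∑ₗ-const 4 C ⟩
  length C * 4                                 ∎
  where
  size : ∀ B → B ∈ₗ C → ∑[ x < n ] 𝟙 (lookup B x) ≡ 4
  size B B∈C = begin
    ∑[ x < n ] 𝟙 (lookup B x)         ≡⟨ sum-cong-≗ (λ x → *-identityʳ (𝟙 (lookup B x))) ⟨
    sumOn B (λ _ → 1)                 ≡⟨ ∣∣≡sumOn B ⟨
    ∣ B ∣                             ≡⟨ block-size B B∈C ⟩
    4                                 ∎

multiple-of-4-even : 1 ≤ n → (q : ℕ) → n ≡ q * 4 → ∃ λ m → n ≡ suc m + suc m
multiple-of-4-even 1≤n zero refl with () ← 1≤n
multiple-of-4-even _ (suc q) refl = suc (q + q) , regroup q
  where
  regroup : ∀ q → suc q * 4 ≡ suc (suc (q + q)) + suc (suc (q + q))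
  regroup = solve-∀

mainTheorem6 : (n : ℕ) → 1 ≤ n → (𝓑 : List (Subset n)) →
    IsKQS n 𝓑 → MinSumIs 𝓑 (n + 2) →
    Σ (List (Subset (2 * n))) λ 𝓑′ → IsKQS (2 * n) 𝓑′ × MinSumIs 𝓑′ (2 * n + 2)
mainTheorem6 n 1≤n 𝓑 kqs@((block-size , _) , R , R↭𝓑 , R-parallel) minSum@((B₀ , B₀∈𝓑 , _) , _)
  with C , B₀∈C , C∈R ← ∈-concat⁻′ R (↭.∈-resp-↭ (↭-sym R↭𝓑) B₀∈𝓑)
  with m , refl ← multiple-of-4-even 1≤n (length C) (parallelClass-size (R-parallel C C∈R)
                    (λ B B∈C → block-size B (↭.∈-resp-↭ R↭𝓑 (∈-concat⁺′ B∈C C∈R))))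
  with 𝓕 , 𝓕-factorisation ← oneFactorisation-even m =
  subst (λ k → Σ (List (Subset k)) λ 𝓑′ → IsKQS k 𝓑′ × MinSumIs 𝓑′ (k + 2))
        (cong (suc m + suc m +_) (sym (+-identityʳ (suc m + suc m))))
        (kqs-doubling kqs minSum 𝓕-factorisation)
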